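{- Let $n\ge 2$ be an integer and $q$ a prime power. There exist $N\ge 1$ and a cyclic sequence $\mathcal{C}=(p_i)_{i\in\mathbb{Z}/N\mathbb{Z}}$ of points of $\mathrm{PG}(n,q)$ such that (1) for every $i$, the window $(p_i,p_{i+1})$ represents a well-defined affine line of $\mathrm{AG}(n,q)$, and (2) every affine line of $\mathrm{AG}(n,q)$ is represented by exactly one window $(p_i,p_{i+1})$, $i\in\mathbb{Z}/N\mathbb{Z}$. (The points $p_i$ may be affine points or points at infinity.)
   Context: $\mathrm{AG}(n,q)$ denotes the affine space $\mathbb{F}_q^{\,n}$; its affine lines are the sets $x+\ell$ with $x\in\mathbb{F}_q^{\,n}$ and $\ell\subset\mathbb{F}_q^{\,n}$ a $1$-dimensional linear subspace (the direction of the line). $\mathrm{PG}(n,q)$ is the projective completion of $\mathrm{AG}(n,q)$: its points are the affine points $x\in\mathbb{F}_q^{\,n}$ together with the points of the hyperplane at infinity, which are the symbols $[\ell]$, one for each $1$-dimensional subspace $\ell\subset\mathbb{F}_q^{\,n}$. A window $(p,p')$ of two points of $\mathrm{PG}(n,q)$ represents an affine line as follows: if $p,p'$ are distinct affine points, it represents the unique affine line through $p$ and $p'$; if one of them is an affine point $x$ and the other is a point at infinity $[\ell]$, it represents the affine line $x+\ell$; in all other cases (equal points, or two points at infinity) the window does not represent an affine line. -}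

module Defs where

open import Level using (Level; _⊔_; suc)
open import Algebra.Bundles using (CommutativeRing)
open import Data.Nat as ℕ using (ℕ; _≥_; _^_; NonZero)
open import Data.Nat.DivMod using (_mod_)
open import Data.Nat.Primality using (Prime)
open import Data.Fin using (Fin; toℕ)
open import Data.Product using (Σ; ∃; ∃-syntax; _×_; _,_)
open import Data.Empty using (⊥)
open import Relation.Nullary using (¬_)
open import Relation.Binary.PropositionalEquality using (_≡_)

IsPrimePower : ℕ → Set
IsPrimePower q = ∃[ p ] ∃[ k ] (Prime p × k ≥ 1 × q ≡ p ^ k)

record IsField {c ℓ : Level} (R : CommutativeRing c ℓ) : Set (c ⊔ ℓ) where
  open CommutativeRing R
  field
    1≉0    : ¬ (1# ≈ 0#)
    inverse : ∀ x → ¬ (x ≈ 0#) → ∃[ y ] (x * y ≈ 1#)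

record HasCardinality {c ℓ : Level} (R : CommutativeRing c ℓ) (q : ℕ) : Set (c ⊔ ℓ) where
  open CommutativeRing R
  field
    enum       : Fin q → Carrier
    enum-inj   : ∀ i j → enum i ≈ enum j → i ≡ j
    enum-surj  : ∀ x → ∃[ i ] (enum i ≈ x)

next : {N : ℕ} .{{_ : NonZero N}} → Fin N → Fin N
next {N} i = ℕ.suc (toℕ i) mod N

module Geometry {c ℓ : Level} (R : CommutativeRing c ℓ) (n : ℕ) where
  open CommutativeRing R

  Vec : Set c
  Vec = Fin n → Carrier

  _≋_ : Vec → Vec → Set ℓ
  x ≋ y = ∀ k → x k ≈ y k

  _⊕_ : Vec → Vec → Vec
  (x ⊕ y) k = x k + y k

  _⊖_ : Vec → Vec → Vec
  (x ⊖ y) k = x k - y k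

  _·_ : Carrier → Vec → Vec
  (t · x) k = t * x k

  NonZeroVec : Vec → Set ℓ
  NonZeroVec d = ¬ (d ≋ (λ _ → 0#))

  -- points of PG(n,q): affine points, or points at infinity [ℓ] where the
  -- 1-dimensional subspace ℓ is given by a spanning (nonzero) vector d.
  data PGPoint : Set (c ⊔ ℓ) where
    aff : Vec → PGPoint
    inf : (d : Vec) → NonZeroVec d → PGPoint

  LineSet : Vec → Vec → Vec → Set (c ⊔ ℓ)
  LineSet x d y = ∃[ t ] (y ≋ (x ⊕ (t · d)))

  SameSet : (Vec → Set (c ⊔ ℓ)) → (Vec → Set (c ⊔ ℓ)) → Set (c ⊔ ℓ)
  SameSet A B = ∀ y → (A y → B y) × (B y → A y)

  IsAffineLine : (Vec → Set (c ⊔ ℓ)) → Set (c ⊔ ℓ)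
  IsAffineLine L = ∃[ x ] ∃[ d ] (NonZeroVec d × SameSet L (LineSet x d))

  Represents : PGPoint → PGPoint → (Vec → Set (c ⊔ ℓ)) → Set (c ⊔ ℓ)
  Represents (aff x)   (aff y)   L = ¬ (x ≋ y) × SameSet L (LineSet x (y ⊖ x))
  Represents (aff x)   (inf d _) L = SameSet L (LineSet x d)
  Represents (inf d _) (aff x)   L = SameSet L (LineSet x d)
  Represents (inf _ _) (inf _ _) L = Lift⊥
    where
    Lift⊥ : Set (c ⊔ ℓ)
    Lift⊥ = Level.Lift (c ⊔ ℓ) ⊥

  RepresentsSomeLine : PGPoint → PGPoint → Set (suc (c ⊔ ℓ))
  RepresentsSomeLine p p' = ∃[ L ] (IsAffineLine L × Represents p p' L)

-- A line of AG(n,q) either lies in one of the q hyperplanes x₀ = a, where it is a line of AG(n-1,q),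
-- or is transversal: it meets x₀ = 0 in a point (0 , u) and has a point at infinity [(1 , v)]. Numbering
-- the vectors u, v by 0 … Q-1 (Q = q^(n-1)), the transversal lines with v - u ≡ d (mod Q) form a class D d.
-- A cyclic sequence as required is a closed walk in PG(n,q) whose windows carry the lines as labels,
-- each line once; two closed walks through a common point splice into one.
-- The zigzag (0,u₀) , [(1,u₀+d+1)] , (0,u₀+1) , [(1,u₀+d+2)] , … is a closed walk with labels D (d+1) ∪ D d,
-- so pairing the classes covers all transversal lines when Q is even; when Q is odd, one extra family of
-- affine points lets a single closed walk cover five classes. The lines in the hyperplanes are covered by
-- copies of the walk for AG(n-1,q), spliced in at the origin and at the point at infinity of the last axis,
-- which all the hyperplanes x₀ = a share. In the plane the q vertical lines are collected instead by detours
-- through the vertical point at infinity.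

module Submission where

open import Defs
open import Level using (Level)
open import Algebra.Bundles using (CommutativeRing)
open import Data.Nat using (ℕ; _≥_; suc)
open import Data.Fin using (Fin)
open import Data.Product using (Σ; ∃; ∃-syntax; _×_; _,_)
open import Relation.Binary.PropositionalEquality using (_≡_)
open import Level using (_⊔_)
open import Relation.Binary using (Setoid)
open import Data.Nat using (zero; s≤s)
open import Data.Fin using (zero)
open import Data.Empty using (⊥-elim)

module Lists where
  open import Data.Nat using (_+_; _∸_; _*_; _≤_; _<_)
  open import Data.Nat.Properties
  open import Data.Nat.DivMod
  open import Data.List using (List; []; _∷_; _++_; _∷ʳ_; map; concatMap; cartesianProductWith)
  open import Data.List.Properties using (map-++; map-cong-local; concatMap-++)
  open import Data.List.Membership.Propositional using (_∈_)
  open import Data.List.Relation.Unary.Any using (here; there)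
  open import Data.List.Relation.Unary.All using (All)
  import Data.List.Relation.Unary.All as All
  open import Data.List.Relation.Unary.Unique.Propositional using (Unique; []; _∷_)
  open import Data.List.Relation.Binary.Permutation.Propositional
    using (_↭_; ↭-refl; ↭-trans; ↭-reflexive; prep; swap; ↭⇒↭ₛ; module PermutationReasoning)
  import Data.List.Relation.Binary.Permutation.Setoid.Properties as SetoidPerm
  import Data.List.Relation.Binary.Permutation.Propositional as Perm
  open import Data.List.Relation.Binary.Permutation.Propositional.Properties
    using (++⁺ˡ; ++⁺; ++-comm; shifts)
  open import Data.Product using (proj₁; proj₂)
  open import Data.Nat.Tactic.RingSolver using (solve-∀)
  open import Data.Sum using (inj₁; inj₂)
  open import Relation.Binary.PropositionalEquality

  interval : ℕ → ℕ → List ℕ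
  interval a zero    = []
  interval a (suc k) = a ∷ interval (suc a) k

  interval-++ : ∀ a k l → interval a (k + l) ≡ interval a k ++ interval (a + k) l
  interval-++ a zero    l = cong (λ b → interval b l) (sym (+-identityʳ a))
  interval-++ a (suc k) l = cong (a ∷_)
    (trans (interval-++ (suc a) k l) (cong (λ b → interval (suc a) k ++ interval b l) (sym (+-suc a k))))

  interval-∷ʳ : ∀ a k → interval a (suc k) ≡ interval a k ∷ʳ (a + k)
  interval-∷ʳ a k = trans (cong (interval a) (+-comm 1 k)) (interval-++ a k 1)

  map-∸-interval : ∀ a b k → map (_∸ a) (interval (a + b) k) ≡ interval b k
  map-∸-interval a b zero    = refl
  map-∸-interval a b (suc k) = cong₂ _∷_ (m+n∸m≡n a b)
    (trans (cong (λ c → map (_∸ a) (interval c k)) (sym (+-suc a b))) (map-∸-interval a (suc b) k))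

  map-suc-interval : ∀ a k → map suc (interval a k) ≡ interval (suc a) k
  map-suc-interval a zero    = refl
  map-suc-interval a (suc k) = cong (suc a ∷_) (map-suc-interval (suc a) k)

  ∈-interval⁺ : ∀ {a k i} → a ≤ i → i < a + k → i ∈ interval a k
  ∈-interval⁺ {a} {zero}  a≤i i<a+k = ⊥-elim (<-irrefl refl (<-≤-trans i<a+k (subst (_≤ _) (sym (+-identityʳ a)) a≤i)))
  ∈-interval⁺ {a} {suc k} {i} a≤i i<a+k with m≤n⇒m<n∨m≡n a≤i
  ... | inj₂ refl = here refl
  ... | inj₁ a<i  = there (∈-interval⁺ a<i (subst (i <_) (+-suc a k) i<a+k))

  ∈-interval⁻ : ∀ {a k i} → i ∈ interval a k → a ≤ i × i < a + k
  ∈-interval⁻ {a} {suc k} (here refl) = ≤-refl , subst (a <_) (sym (+-suc a k)) (s≤s (m≤m+n a k))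
  ∈-interval⁻ {a} {suc k} {i} (there i∈) with ∈-interval⁻ i∈
  ... | a<i , i<a+k = <⇒≤ a<i , subst (i <_) (sym (+-suc a k)) i<a+k

  interval-unique : ∀ a k → Unique (interval a k)
  interval-unique a zero    = []
  interval-unique a (suc k) = All.tabulate (λ i∈ a≡i → <-irrefl a≡i (proj₁ (∈-interval⁻ i∈))) ∷ interval-unique (suc a) k

  Unique-resp-↭ : ∀ {a} {A : Set a} {xs ys : List A} → xs ↭ ys → Unique xs → Unique ys
  Unique-resp-↭ {A = A} p = SetoidPerm.Unique-resp-↭ (setoid A) (↭⇒↭ₛ p)

  double : ℕ → ℕ
  double zero    = zero
  double (suc k) = suc (suc (double k))

  double≡+ : ∀ h → double h ≡ h + h
  double≡+ zero    = refl
  double≡+ (suc h) = cong suc (trans (cong suc (double≡+ h)) (sym (+-suc h h)))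

  data Parity (n : ℕ) : Set where
    even : ∀ h → n ≡ double h → Parity n
    odd  : ∀ h → n ≡ suc (double h) → Parity n

  parity : ∀ n → Parity n
  parity zero = even zero refl
  parity (suc n) with parity n
  ... | even h n≡2h   = odd h (cong suc n≡2h)
  ... | odd h n≡1+2h  = even (suc h) (cong suc n≡1+2h)

  every-other : ℕ → ℕ → List ℕ
  every-other b zero    = []
  every-other b (suc k) = b ∷ every-other (suc (suc b)) k

  with-suc : ℕ → List ℕ
  with-suc e = suc e ∷ e ∷ []

  concatMap-with-suc-every-other : ∀ b k → concatMap with-suc (every-other b k) ↭ interval b (double k)
  concatMap-with-suc-every-other b zero    = ↭-refl
  concatMap-with-suc-every-other b (suc k) = swap (suc b) b (concatMap-with-suc-every-other (suc (suc b)) k)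

  concatMap⁺ : ∀ {A B : Set} (f : A → List B) {xs ys} → xs ↭ ys → concatMap f xs ↭ concatMap f ys
  concatMap⁺ f Perm.refl         = ↭-refl
  concatMap⁺ f (prep x p)        = ++⁺ˡ (f x) (concatMap⁺ f p)
  concatMap⁺ f (swap x y p)      = ↭-trans (shifts (f x) (f y)) (++⁺ˡ (f y) (++⁺ˡ (f x) (concatMap⁺ f p)))
  concatMap⁺ f (Perm.trans p q)  = ↭-trans (concatMap⁺ f p) (concatMap⁺ f q)

  concatMap-∷-↭ : ∀ {a b} {A : Set a} {B : Set b} (f : A → B) (g : A → List B) xs →
    concatMap (λ x → f x ∷ g x) xs ↭ map f xs ++ concatMap g xs
  concatMap-∷-↭ f g []       = ↭-refl
  concatMap-∷-↭ f g (x ∷ xs) = prep (f x) (↭-trans (++⁺ˡ (g x) (concatMap-∷-↭ f g xs)) (shifts (g x) (map f xs)))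

  concatMap-[-] : ∀ {A B : Set} (f : A → B) xs → concatMap (λ x → f x ∷ []) xs ≡ map f xs
  concatMap-[-] f []       = refl
  concatMap-[-] f (x ∷ xs) = cong (f x ∷_) (concatMap-[-] f xs)

  concatMap-cong-↭ : ∀ {A B : Set} {f g : A → List B} → (∀ x → f x ↭ g x) → ∀ xs → concatMap f xs ↭ concatMap g xs
  concatMap-cong-↭ f↭g []       = ↭-refl
  concatMap-cong-↭ f↭g (x ∷ xs) = ++⁺ (f↭g x) (concatMap-cong-↭ f↭g xs)

  concatMap-concatMap : ∀ {A B C : Set} (f : B → List C) (g : A → List B) xs →
    concatMap f (concatMap g xs) ≡ concatMap (λ x → concatMap f (g x)) xs
  concatMap-concatMap f g []       = refl
  concatMap-concatMap f g (x ∷ xs) =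
    trans (concatMap-++ f (g x) (concatMap g xs)) (cong (concatMap f (g x) ++_) (concatMap-concatMap f g xs))

  concatMap-transpose-↭ : ∀ {a b} {A : Set a} {B : Set b} (fs : List (A → B)) xs →
    concatMap (λ x → map (λ f → f x) fs) xs ↭ concatMap (λ f → map f xs) fs
  concatMap-transpose-↭ []       xs = ↭-reflexive (concatMap-[] xs)
    where
    concatMap-[] : ∀ xs → concatMap (λ _ → []) xs ≡ []
    concatMap-[] []       = refl
    concatMap-[] (_ ∷ xs) = concatMap-[] xs
  concatMap-transpose-↭ (f ∷ fs) xs =
    ↭-trans (concatMap-∷-↭ f (λ x → map (λ f → f x) fs) xs) (++⁺ˡ (map f xs) (concatMap-transpose-↭ fs xs))

  cartesianProductWith-concatMap : ∀ {A B C : Set} (f : A → B → C) xs ys →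
    cartesianProductWith f xs ys ≡ concatMap (λ x → map (f x) ys) xs
  cartesianProductWith-concatMap f []       ys = refl
  cartesianProductWith-concatMap f (x ∷ xs) ys = cong (map (f x) ys ++_) (cartesianProductWith-concatMap f xs ys)

  module Modular (Q′ : ℕ) where

    Q : ℕ
    Q = suc Q′

    %-absorbˡ : ∀ a d → (a % Q + d) % Q ≡ (a + d) % Q
    %-absorbˡ a d = begin
      (a % Q + d) % Q           ≡⟨ %-distribˡ-+ (a % Q) d Q ⟩
      (a % Q % Q + d % Q) % Q   ≡⟨ cong (λ t → (t + d % Q) % Q) (m%n%n≡m%n a Q) ⟩
      (a % Q + d % Q) % Q       ≡⟨ %-distribˡ-+ a d Q ⟨
      (a + d) % Q               ∎
      where open ≡-Reasoning

    %-absorbʳ : ∀ a d → (a + d % Q) % Q ≡ (a + d) % Q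
    %-absorbʳ a d = trans (cong (_% Q) (+-comm a (d % Q))) (trans (%-absorbˡ d a) (cong (_% Q) (+-comm d a)))

    suc-%-+ : ∀ i d → (suc i % Q + d) % Q ≡ (i + suc d) % Q
    suc-%-+ i d = trans (%-absorbˡ (suc i) d) (cong (_% Q) (sym (+-suc i d)))

    private
      +-∸-% : ∀ i d → (i + d + (Q ∸ i % Q)) % Q ≡ d % Q
      +-∸-% i d = begin
        (i + d + t) % Q              ≡⟨ cong (λ i′ → (i′ + d + t) % Q) (m≡m%n+[m/n]*n i Q) ⟩
        (r + k * Q + d + t) % Q      ≡⟨ cong (_% Q) (rearrange r k d t Q) ⟩
        (d + (r + t) + k * Q) % Q    ≡⟨ cong (λ s → (d + s + k * Q) % Q) (m+[n∸m]≡n (<⇒≤ (m%n<n i Q))) ⟩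
        (d + Q + k * Q) % Q          ≡⟨ cong (_% Q) (+-assoc d Q (k * Q)) ⟩
        (d + suc k * Q) % Q          ≡⟨ [m+kn]%n≡m%n d (suc k) Q ⟩
        d % Q                        ∎
        where
        open ≡-Reasoning
        r = i % Q
        k = i / Q
        t = Q ∸ r
        rearrange : ∀ r k d t Q → r + k * Q + d + t ≡ d + (r + t) + k * Q
        rearrange = solve-∀

    +-%-cancelˡ : ∀ i {d d′} → d < Q → d′ < Q → (i + d) % Q ≡ (i + d′) % Q → d ≡ d′
    +-%-cancelˡ i {d} {d′} d<Q d′<Q eq = begin
      d                                  ≡⟨ m<n⇒m%n≡m d<Q ⟨
      d % Q                              ≡⟨ +-∸-% i d ⟨
      (i + d + (Q ∸ i % Q)) % Q          ≡⟨ %-absorbˡ (i + d) (Q ∸ i % Q) ⟨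
      ((i + d) % Q + (Q ∸ i % Q)) % Q    ≡⟨ cong (λ s → (s + (Q ∸ i % Q)) % Q) eq ⟩
      ((i + d′) % Q + (Q ∸ i % Q)) % Q   ≡⟨ %-absorbˡ (i + d′) (Q ∸ i % Q) ⟩
      (i + d′ + (Q ∸ i % Q)) % Q         ≡⟨ +-∸-% i d′ ⟩
      d′ % Q                             ≡⟨ m<n⇒m%n≡m d′<Q ⟩
      d′                                 ∎
      where open ≡-Reasoning

    +-%-solve : ∀ {i j} → i < Q → j < Q → Σ ℕ λ d → d < Q × (i + d) % Q ≡ j
    +-%-solve {i} {j} i<Q j<Q = (j + (Q ∸ i)) % Q , m%n<n (j + (Q ∸ i)) Q , (begin
      (i + (j + (Q ∸ i)) % Q) % Q   ≡⟨ %-absorbʳ i (j + (Q ∸ i)) ⟩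
      (i + (j + (Q ∸ i))) % Q       ≡⟨ cong (_% Q) (x+[y+z]≡y+[x+z] i j (Q ∸ i)) ⟩
      (j + (i + (Q ∸ i))) % Q       ≡⟨ cong (λ s → (j + s) % Q) (m+[n∸m]≡n (<⇒≤ i<Q)) ⟩
      (j + Q) % Q                   ≡⟨ [m+n]%n≡m%n j Q ⟩
      j % Q                         ≡⟨ m<n⇒m%n≡m j<Q ⟩
      j                             ∎)
      where
      open ≡-Reasoning
      x+[y+z]≡y+[x+z] : ∀ x y z → x + (y + z) ≡ y + (x + z)
      x+[y+z]≡y+[x+z] = solve-∀

    map-suc-%-interval : map (λ i → suc i % Q) (interval 0 Q) ↭ interval 0 Q
    map-suc-%-interval = begin
      map (λ i → suc i % Q) (interval 0 Q)                 ≡⟨ cong (map (λ i → suc i % Q)) (interval-∷ʳ 0 Q′) ⟩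
      map (λ i → suc i % Q) (interval 0 Q′ ∷ʳ Q′)          ≡⟨ map-++ (λ i → suc i % Q) (interval 0 Q′) (Q′ ∷ []) ⟩
      map (λ i → suc i % Q) (interval 0 Q′) ∷ʳ Q % Q       ≡⟨ cong₂ _∷ʳ_ below-Q′ (n%n≡0 Q) ⟩
      interval 1 Q′ ∷ʳ 0                                   ↭⟨ ++-comm (interval 1 Q′) (0 ∷ []) ⟩
      interval 0 Q                                         ∎
      where
      open PermutationReasoning
      below-Q′ : map (λ i → suc i % Q) (interval 0 Q′) ≡ interval 1 Q′
      below-Q′ = trans (map-cong-local (All.tabulate (λ i∈ → m<n⇒m%n≡m (s≤s (proj₂ (∈-interval⁻ i∈))))))
                       (map-suc-interval 0 Q′)

module ClosedWalks {a e b r : Level} (S : Setoid a e) {K : Set b}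
  (Edge : Setoid.Carrier S → Setoid.Carrier S → K → Set r)
  (Edge-respʳ : ∀ {p z z′ k} → Setoid._≈_ S z z′ → Edge p z k → Edge p z′ k) where

  open import Data.Nat using (_+_; _<_; _≤_; z≤n)
  open import Data.Nat.Properties using (m≤n⇒m<n∨m≡n; ≤-refl; <⇒≤; +-identityʳ; +-suc; m<m+n)
  open import Data.Nat.DivMod using (_%_; m<n⇒m%n≡m; n%n≡0; m%n<n)
  open import Data.Fin as Fin using (Fin; toℕ)
  open import Data.Fin.Properties using (toℕ<n; toℕ-fromℕ<)
  open import Data.List using (List; []; _∷_; _++_; map; concat; concatMap; length; lookup)
  open Lists using (interval; Unique-resp-↭; concatMap-transpose-↭)
  open import Data.List.Properties using (++-assoc; ++-identityʳ; map-concatMap; concatMap-cong)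
  open import Data.List.Membership.Propositional using (_∈_)
  open import Data.List.Membership.Propositional.Properties using (∈-lookup; ∈-map⁺)
  open import Data.List.Relation.Unary.Any as Any using (Any; here; there)
  open import Data.List.Relation.Unary.Any.Properties using (lookup-index)
  import Data.List.Relation.Unary.Any.Properties as Any
  open import Data.List.Relation.Unary.All using (All; []; _∷_)
  open import Data.List.Relation.Unary.AllPairs using (AllPairs; []; _∷_)
  import Data.List.Relation.Unary.All as All
  import Data.List.Relation.Unary.AllPairs.Properties as AllPairs
  open import Data.List.Relation.Unary.Unique.Propositional using (Unique)
  open import Data.List.Relation.Binary.Permutation.Propositional
    using (_↭_; ↭-trans; ↭-sym; ↭-reflexive; module PermutationReasoning)
  open import Data.List.Relation.Binary.Permutation.Propositional.Properties
    using (++⁺; ++⁺ˡ; ++⁺ʳ; ++-comm; Any-resp-↭; ∈-resp-↭)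
  open import Data.Product using (proj₁; proj₂)
  open import Data.Sum using (inj₁; inj₂)
  open import Data.Unit.Polymorphic using (⊤)
  open import Relation.Binary.PropositionalEquality as ≡ using (_≡_; _≢_; refl; subst)

  open Setoid S using (_≈_; sym; trans) renaming (Carrier to V)

  Walk : Set (a ⊔ b)
  Walk = List (V × K)

  start : Walk → V → V
  start []            z = z
  start ((p , _) ∷ _) _ = p

  Steps : Walk → V → Set r
  Steps []            z = ⊤
  Steps ((p , k) ∷ w) z = Edge p (start w z) k × Steps w z

  -- z only matters for the empty walk.
  IsClosed : Walk → Set (a ⊔ r)
  IsClosed w = ∀ z → Steps w (start w z)

  labels : Walk → List K
  labels = map proj₂

  Visits : Walk → V → Set (a ⊔ b ⊔ e)
  Visits w x = Any (λ v → proj₁ v ≈ x) w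

  start-++ : ∀ xs ys z → start (xs ++ ys) z ≡ start xs (start ys z)
  start-++ []      ys z = refl
  start-++ (_ ∷ _) ys z = refl

  Steps-++ : ∀ xs ys z → Steps xs (start ys z) → Steps ys z → Steps (xs ++ ys) z
  Steps-++ []                 ys z _        t = t
  Steps-++ ((p , k) ∷ xs) ys z (e , s) t =
    subst (λ u → Edge p u k) (≡.sym (start-++ xs ys z)) e , Steps-++ xs ys z s t

  Steps-++⁻ : ∀ xs ys z → Steps (xs ++ ys) z → Steps xs (start ys z) × Steps ys z
  Steps-++⁻ []             ys z t       = _ , t
  Steps-++⁻ ((p , k) ∷ xs) ys z (e , t) with Steps-++⁻ xs ys z t
  ... | s , t′ = (subst (λ u → Edge p u k) (start-++ xs ys z) e , s) , t′

  Steps-respʳ : ∀ w {z z′} → z ≈ z′ → Steps w z → Steps w z′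
  Steps-respʳ []                 z≈z′ _       = _
  Steps-respʳ ((p , k) ∷ [])     z≈z′ (e , _) = Edge-respʳ z≈z′ e , _
  Steps-respʳ ((p , k) ∷ x ∷ w)  z≈z′ (e , s) = e , Steps-respʳ (x ∷ w) z≈z′ s

  Steps-blocks : ∀ (g : ℕ → Walk) (h : ℕ → V) → (∀ i z → start (g i) z ≡ h i) → ∀ a k {z} →
                 (∀ i → a ≤ i → i < a + k → Steps (g i) (h (suc i))) → Steps (g (a + k)) z →
                 Steps (concatMap g (interval a (suc k))) z
  Steps-blocks g h starts a zero {z} _ last =
    Steps-++ (g a) [] z (subst (λ i → Steps (g i) z) (+-identityʳ a) last) _
  Steps-blocks g h starts a (suc k) {z} inner last =
    Steps-++ (g a) (concatMap g (interval (suc a) (suc k))) z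
      (subst (Steps (g a)) (≡.sym (≡.trans (start-++ (g (suc a)) _ z) (starts (suc a) _)))
        (inner a ≤-refl (m<m+n a (s≤s z≤n))))
      (Steps-blocks g h starts (suc a) k
        (λ i a<i i<1+a+k → inner i (<⇒≤ a<i) (subst (i <_) (≡.sym (+-suc a k)) i<1+a+k))
        (subst (λ i → Steps (g i) z) (+-suc a k) last))

  labels-blocks : ∀ (block : ℕ → Walk) cols → (∀ i → labels (block i) ≡ map (λ f → f i) cols) → ∀ is →
                  labels (concatMap block is) ↭ concatMap (λ f → map f is) cols
  labels-blocks block cols block-labels is = begin
    labels (concatMap block is)                    ≡⟨ map-concatMap proj₂ block is ⟩
    concatMap (λ i → labels (block i)) is          ≡⟨ concatMap-cong block-labels is ⟩
    concatMap (λ i → map (λ f → f i) cols) is      ↭⟨ concatMap-transpose-↭ cols is ⟩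
    concatMap (λ f → map f is) cols                ∎
    where open PermutationReasoning

  IsLoopAt : V → Walk → Set (a ⊔ r)
  IsLoopAt x w = start w x ≡ x × Steps w x

  loop-++ : ∀ {x w₁ w₂} → IsLoopAt x w₁ → IsLoopAt x w₂ → IsLoopAt x (w₁ ++ w₂)
  loop-++ {x} {w₁} {w₂} (start₁ , steps₁) (start₂ , steps₂) =
    ≡.trans (start-++ w₁ w₂ x) (≡.trans (≡.cong (start w₁) start₂) start₁) ,
    Steps-++ w₁ w₂ x (subst (Steps w₁) (≡.sym start₂) steps₁) steps₂

  loop-concatMap : ∀ {A : Set} {x} (g : A → Walk) → (∀ y → IsLoopAt x (g y)) → ∀ ys → IsLoopAt x (concatMap g ys)
  loop-concatMap g loops []       = refl , _
  loop-concatMap g loops (y ∷ ys) = loop-++ (loops y) (loop-concatMap g loops ys)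

  IsLoopAt⇒IsClosed : ∀ {x} w → IsLoopAt x w → IsClosed w
  IsLoopAt⇒IsClosed []      _               _ = _
  IsLoopAt⇒IsClosed (y ∷ w) (refl , steps) _ = steps

  rotate : ∀ A v k B → IsClosed (A ++ (v , k) ∷ B) → IsClosed ((v , k) ∷ B ++ A)
  rotate A v k B closed _ with Steps-++⁻ A ((v , k) ∷ B) _ (subst (Steps (A ++ (v , k) ∷ B)) (start-++ A ((v , k) ∷ B) v) (closed v))
  ... | sA , sB = Steps-++ ((v , k) ∷ B) A v sB sA

  join : ∀ {v k B v′ k′ B′} → v ≈ v′ → IsClosed ((v , k) ∷ B) → IsClosed ((v′ , k′) ∷ B′) →
         IsClosed ((v , k) ∷ B ++ (v′ , k′) ∷ B′)
  join {v} {k} {B} {v′} {k′} {B′} v≈v′ closed closed′ _ =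
    Steps-++ ((v , k) ∷ B) ((v′ , k′) ∷ B′) v
      (Steps-respʳ ((v , k) ∷ B) v≈v′ (closed v)) (Steps-respʳ ((v′ , k′) ∷ B′) (sym v≈v′) (closed′ v′))

  split-at-visit : ∀ {w x} → Visits w x → Σ Walk λ A → Σ V λ v → Σ K λ k → Σ Walk λ B → w ≡ A ++ (v , k) ∷ B × v ≈ x
  split-at-visit {(v , k) ∷ B} (here v≈x) = [] , v , k , B , refl , v≈x
  split-at-visit {y ∷ _} (there visit) with split-at-visit visit
  ... | A , v , k , B , refl , v≈x = y ∷ A , v , k , B , refl , v≈x

  splice : ∀ {w₁ w₂ x} → Visits w₁ x → Visits w₂ x → IsClosed w₁ → IsClosed w₂ →
           Σ Walk λ w → IsClosed w × w ↭ w₁ ++ w₂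
  splice visit₁ visit₂ closed₁ closed₂ with split-at-visit visit₁ | split-at-visit visit₂
  ... | A₁ , v₁ , k₁ , B₁ , refl , v₁≈x | A₂ , v₂ , k₂ , B₂ , refl , v₂≈x =
    (v₁ , k₁) ∷ B₁ ++ A₁ ++ (v₂ , k₂) ∷ B₂ ++ A₂ ,
    subst IsClosed (≡.cong ((v₁ , k₁) ∷_) (++-assoc B₁ A₁ _))
      (join (trans v₁≈x (sym v₂≈x)) (rotate A₁ v₁ k₁ B₁ closed₁) (rotate A₂ v₂ k₂ B₂ closed₂)) ,
    subst (_↭ (A₁ ++ (v₁ , k₁) ∷ B₁) ++ A₂ ++ (v₂ , k₂) ∷ B₂) (≡.cong ((v₁ , k₁) ∷_) (++-assoc B₁ A₁ _))
      (++⁺ (++-comm ((v₁ , k₁) ∷ B₁) A₁) (++-comm ((v₂ , k₂) ∷ B₂) A₂))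

  splice-all : ∀ {w x} → Visits w x → IsClosed w → ∀ ws → All (λ w′ → Visits w′ x × IsClosed w′) ws →
               Σ Walk λ w′ → IsClosed w′ × w′ ↭ w ++ concat ws
  splice-all {w} visit closed [] [] = w , closed , ↭-sym (↭-reflexive (++-identityʳ w))
  splice-all {w} visit closed (w₁ ∷ ws) ((visit₁ , closed₁) ∷ rest)
    with splice visit visit₁ closed closed₁
  ... | w′ , closed′ , w′↭ with splice-all (Any-resp-↭ (↭-sym w′↭) (Any.++⁺ˡ visit)) closed′ ws rest
  ... | w″ , closed″ , w″↭ = w″ , closed″ , ↭-trans w″↭ (↭-trans (++⁺ʳ _ w′↭) (↭-reflexive (++-assoc w w₁ (concat ws))))

  vertexAt : Walk → V → ℕ → V
  vertexAt []            z _       = z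
  vertexAt ((p , _) ∷ w) z zero    = p
  vertexAt (_ ∷ w)       z (suc j) = vertexAt w z j

  labelAt : (w : Walk) → Fin (length w) → K
  labelAt w i = proj₂ (lookup w i)

  vertexAt-length : ∀ w z → vertexAt w z (length w) ≡ z
  vertexAt-length []      z = refl
  vertexAt-length (_ ∷ w) z = vertexAt-length w z

  Steps⇒Edge : ∀ w z → Steps w z → ∀ i → Edge (vertexAt w z (toℕ i)) (vertexAt w z (suc (toℕ i))) (labelAt w i)
  Steps⇒Edge (_ ∷ [])    z (e , _) Fin.zero    = e
  Steps⇒Edge (_ ∷ _ ∷ _) z (e , _) Fin.zero    = e
  Steps⇒Edge (_ ∷ w)     z (_ , s) (Fin.suc i) = Steps⇒Edge w z s i

  module _ (x : V × K) (w : Walk) where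

    private
      base = proj₁ x
      W    = x ∷ w
      N    = suc (length w)

    vertexAt-next : ∀ i → vertexAt W base (suc (toℕ i)) ≡ vertexAt W base (toℕ (next i))
    vertexAt-next i with m≤n⇒m<n∨m≡n (toℕ<n i)
    ... | inj₁ 1+i<N = ≡.cong (vertexAt W base) (≡.sym (≡.trans (toℕ-fromℕ< (m%n<n (suc (toℕ i)) N)) (m<n⇒m%n≡m 1+i<N)))
    ... | inj₂ 1+i≡N = begin
      vertexAt W base (suc (toℕ i))           ≡⟨ ≡.cong (vertexAt W base) 1+i≡N ⟩
      vertexAt W base N                       ≡⟨ vertexAt-length W base ⟩
      base                                    ≡⟨⟩
      vertexAt W base 0                       ≡⟨ ≡.cong (vertexAt W base) (≡.trans (≡.cong (_% N) 1+i≡N) (n%n≡0 N)) ⟨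
      vertexAt W base (suc (toℕ i) % N)       ≡⟨ ≡.cong (vertexAt W base) (toℕ-fromℕ< (m%n<n (suc (toℕ i)) N)) ⟨
      vertexAt W base (toℕ (next i))          ∎
      where open ≡.≡-Reasoning

    cycle-edges : IsClosed W → ∀ i → Edge (vertexAt W base (toℕ i)) (vertexAt W base (toℕ (next i))) (labelAt W i)
    cycle-edges closed i = subst (λ u → Edge (vertexAt W base (toℕ i)) u (labelAt W i)) (vertexAt-next i) (Steps⇒Edge W base (closed base) i)

  labelAt-complete : ∀ w {κ} → κ ∈ labels w → ∃ λ i → labelAt w i ≡ κ
  labelAt-complete w κ∈ = Any.index κ∈′ , ≡.sym (lookup-index κ∈′)
    where κ∈′ = Any.map⁻ κ∈

  labelAt-injective : ∀ w → Unique (labels w) → ∀ i j → labelAt w i ≡ labelAt w j → i ≡ j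
  labelAt-injective w unique = lookup-injective w (AllPairs.map⁻ unique)
    where
    lookup-injective : ∀ w → AllPairs (λ x y → proj₂ x ≢ proj₂ y) w → ∀ i j → labelAt w i ≡ labelAt w j → i ≡ j
    lookup-injective (_ ∷ w) _          Fin.zero    Fin.zero    _  = refl
    lookup-injective (_ ∷ w) (x# ∷ _)   Fin.zero    (Fin.suc j) eq = ⊥-elim (All.lookup x# (∈-lookup j) eq)
    lookup-injective (_ ∷ w) (x# ∷ _)   (Fin.suc i) Fin.zero    eq = ⊥-elim (All.lookup x# (∈-lookup i) (≡.sym eq))
    lookup-injective (_ ∷ w) (_ ∷ all#) (Fin.suc i) (Fin.suc j) eq = ≡.cong Fin.suc (lookup-injective w all# i j eq)

  module Cycle (x : V × K) (w : Walk) (closed : IsClosed (x ∷ w)) {codes : List K}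
    (labels↭codes : labels (x ∷ w) ↭ codes) (codes-unique : Unique codes) where

    private
      W = x ∷ w

    vertex : Fin (suc (length w)) → V
    vertex i = vertexAt W (proj₁ x) (toℕ i)

    label : Fin (suc (length w)) → K
    label = labelAt W

    edge : ∀ i → Edge (vertex i) (vertex (next i)) (label i)
    edge = cycle-edges x w closed

    label∈codes : ∀ i → label i ∈ codes
    label∈codes i = ∈-resp-↭ labels↭codes (∈-map⁺ proj₂ (∈-lookup i))

    label-surjective : ∀ {κ} → κ ∈ codes → ∃ λ i → label i ≡ κ
    label-surjective κ∈ = labelAt-complete W (∈-resp-↭ (↭-sym labels↭codes) κ∈)

    label-injective : ∀ i j → label i ≡ label j → i ≡ j
    label-injective = labelAt-injective W (Unique-resp-↭ (↭-sym labels↭codes) codes-unique)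

module Fields where
  open Lists using (module Modular)
  open import Data.Nat as ℕ using (ℕ; zero; suc; _<_; _^_; z≤n; s≤s)
  import Data.Nat.Properties as ℕ
  open import Data.Nat.DivMod using (_%_; _/_; m%n<n; m<n⇒m%n≡m; m≡m%n+[m/n]*n; m<n*o⇒m/o<n; [m+kn]%n≡m%n; +-distrib-/; m<n⇒m/n≡0; m*n/n≡m; m*n%n≡0)
  open import Data.Fin as Fin using (Fin; toℕ; fromℕ<)
  import Algebra.Properties.Ring as RingProperties
  import Data.Fin.Properties as Fin
  open import Data.Product using (proj₁; proj₂)
  open import Relation.Nullary using (Dec; yes; no)
  open import Relation.Binary.PropositionalEquality as ≡ using (_≡_)

  module CommutativeRingIdentities {c ℓ : Level} (R : CommutativeRing c ℓ) where

    open CommutativeRing R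
    open RingProperties ring using (-‿distribˡ-*; -‿+-comm)
    open import Algebra.Properties.CommutativeSemigroup +-commutativeSemigroup using () renaming (interchange to +-interchange)
    open import Relation.Binary.Reasoning.Setoid setoid

    x+t*0≈x : ∀ x t → x + t * 0# ≈ x
    x+t*0≈x x t = trans (+-congˡ (zeroʳ t)) (+-identityʳ x)

    x+[y-x]≈y : ∀ x y → x + (y - x) ≈ y
    x+[y-x]≈y x y = begin
      x + (y - x)     ≈⟨ +-congˡ (+-comm y (- x)) ⟩
      x + (- x + y)   ≈⟨ +-assoc x (- x) y ⟨
      (x - x) + y     ≈⟨ +-congʳ (-‿inverseʳ x) ⟩
      0# + y          ≈⟨ +-identityˡ y ⟩
      y               ∎

    [x+y]-x≈y : ∀ x y → (x + y) - x ≈ y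
    [x+y]-x≈y x y = trans (+-congʳ (+-comm x y)) (trans (+-assoc y x (- x)) (trans (+-congˡ (-‿inverseʳ x)) (+-identityʳ y)))

    [x+sd]-[x+td]≈[s-t]d : ∀ x s t d → (x + s * d) - (x + t * d) ≈ (s - t) * d
    [x+sd]-[x+td]≈[s-t]d x s t d = begin
      (x + s * d) - (x + t * d)              ≈⟨ +-congˡ (-‿+-comm x (t * d)) ⟨
      (x + s * d) + (- x + - (t * d))        ≈⟨ +-interchange x (s * d) (- x) (- (t * d)) ⟩
      (x - x) + (s * d + - (t * d))          ≈⟨ +-congʳ (-‿inverseʳ x) ⟩
      0# + (s * d + - (t * d))               ≈⟨ +-identityˡ _ ⟩
      s * d + - (t * d)                      ≈⟨ +-congˡ (-‿distribˡ-* t d) ⟩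
      s * d + (- t) * d                      ≈⟨ distribʳ d s (- t) ⟨
      (s - t) * d                            ∎

    [x′+cb]-[x+ca]≈c[b-a] : ∀ {x x′} c a b → x ≈ x′ → (x′ + c * b) - (x + c * a) ≈ c * (b - a)
    [x′+cb]-[x+ca]≈c[b-a] {x} {x′} c a b x≈x′ = begin
      (x′ + c * b) - (x + c * a)   ≈⟨ +-cong (+-cong (sym x≈x′) (*-comm c b)) (-‿cong (+-congˡ (*-comm c a))) ⟩
      (x + b * c) - (x + a * c)    ≈⟨ [x+sd]-[x+td]≈[s-t]d x b a c ⟩
      (b - a) * c                  ≈⟨ *-comm _ c ⟩
      c * (b - a)                  ∎

  module FieldProperties {c ℓ : Level} (R : CommutativeRing c ℓ) (isField : IsField R) where

    open CommutativeRing R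
    open IsField isField public
    open import Relation.Binary.Reasoning.Setoid setoid

    _⁻¹⟨_⟩ : ∀ x → x ≉ 0# → Carrier
    x ⁻¹⟨ x≉0 ⟩ = proj₁ (inverse x x≉0)

    x*x⁻¹≈1 : ∀ x (x≉0 : x ≉ 0#) → x * x ⁻¹⟨ x≉0 ⟩ ≈ 1#
    x*x⁻¹≈1 x x≉0 = proj₂ (inverse x x≉0)

    x⁻¹*x≈1 : ∀ x (x≉0 : x ≉ 0#) → x ⁻¹⟨ x≉0 ⟩ * x ≈ 1#
    x⁻¹*x≈1 x x≉0 = trans (*-comm _ _) (x*x⁻¹≈1 x x≉0)

    x⁻¹≉0 : ∀ x (x≉0 : x ≉ 0#) → x ⁻¹⟨ x≉0 ⟩ ≉ 0#
    x⁻¹≉0 x x≉0 x⁻¹≈0 = 1≉0 (begin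
      1#                ≈⟨ x⁻¹*x≈1 x x≉0 ⟨
      x ⁻¹⟨ x≉0 ⟩ * x    ≈⟨ *-congʳ x⁻¹≈0 ⟩
      0# * x            ≈⟨ zeroˡ x ⟩
      0#                ∎)

    *-cancelˡ-≈0 : ∀ {x y} → x ≉ 0# → x * y ≈ 0# → y ≈ 0#
    *-cancelˡ-≈0 {x} {y} x≉0 xy≈0 = begin
      y                       ≈⟨ *-identityˡ y ⟨
      1# * y                  ≈⟨ *-congʳ (x⁻¹*x≈1 x x≉0) ⟨
      (x ⁻¹⟨ x≉0 ⟩ * x) * y    ≈⟨ *-assoc _ x y ⟩
      x ⁻¹⟨ x≉0 ⟩ * (x * y)    ≈⟨ *-congˡ xy≈0 ⟩
      x ⁻¹⟨ x≉0 ⟩ * 0#         ≈⟨ zeroʳ _ ⟩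
      0#                      ∎

    *-≉0 : ∀ {x y} → x ≉ 0# → y ≉ 0# → x * y ≉ 0#
    *-≉0 x≉0 y≉0 xy≈0 = y≉0 (*-cancelˡ-≈0 x≉0 xy≈0)

    x-y≉0 : ∀ {x y} → x ≉ y → x - y ≉ 0#
    x-y≉0 {x} {y} x≉y x-y≈0 = x≉y (begin
      x               ≈⟨ +-identityʳ x ⟨
      x + 0#          ≈⟨ +-congˡ (-‿inverseˡ y) ⟨
      x + (- y + y)   ≈⟨ +-assoc x (- y) y ⟨
      (x - y) + y     ≈⟨ +-congʳ x-y≈0 ⟩
      0# + y          ≈⟨ +-identityˡ y ⟩
      y               ∎)

  module FiniteField {c ℓ : Level} (R : CommutativeRing c ℓ) (isField : IsField R) (q₀ : ℕ)
    (card : HasCardinality R (suc (suc q₀))) where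

    open CommutativeRing R
    open HasCardinality card
    open Modular (suc q₀) using (+-%-cancelˡ; +-%-solve) renaming (Q to q)

    _≈?_ : ∀ x y → Dec (x ≈ y)
    x ≈? y with enum-surj x | enum-surj y
    ... | i , i↦x | j , j↦y with i Fin.≟ j
    ... | yes ≡.refl = yes (trans (sym i↦x) j↦y)
    ... | no i≢j     = no (λ x≈y → i≢j (enum-inj i j (trans i↦x (trans x≈y (sym j↦y)))))

    private
      zero-index : ℕ
      zero-index = toℕ (proj₁ (enum-surj 0#))

      zero-index<q : zero-index < q
      zero-index<q = Fin.toℕ<n (proj₁ (enum-surj 0#))

    -- Shifted by the index of 0#, so that element 0 is the zero of the field.
    element : ℕ → Carrier
    element i = enum (fromℕ< (m%n<n (zero-index ℕ.+ i) q))

    private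
      enum-index : ∀ {i j} (j<q : j < q) → (zero-index ℕ.+ i) % q ≡ j → element i ≈ enum (fromℕ< j<q)
      enum-index {i} j<q eq = reflexive (≡.cong enum (Fin.fromℕ<-cong _ _ eq (m%n<n (zero-index ℕ.+ i) q) j<q))

    element-0 : element 0 ≈ 0#
    element-0 = trans (enum-index zero-index<q (≡.trans (≡.cong (_% q) (ℕ.+-identityʳ zero-index)) (m<n⇒m%n≡m zero-index<q)))
                      (trans (reflexive (≡.cong enum (Fin.fromℕ<-toℕ _ zero-index<q))) (proj₂ (enum-surj 0#)))

    element-injective : ∀ {i j} → i < q → j < q → element i ≈ element j → i ≡ j
    element-injective {i} {j} i<q j<q eq = +-%-cancelˡ zero-index i<q j<q (begin
      (zero-index ℕ.+ i) % q                              ≡⟨ Fin.toℕ-fromℕ< _ ⟨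
      toℕ (fromℕ< (m%n<n (zero-index ℕ.+ i) q))           ≡⟨ ≡.cong toℕ (enum-inj _ _ eq) ⟩
      toℕ (fromℕ< (m%n<n (zero-index ℕ.+ j) q))           ≡⟨ Fin.toℕ-fromℕ< _ ⟩
      (zero-index ℕ.+ j) % q                              ∎)
      where open ≡.≡-Reasoning

    element-surjective : ∀ x → Σ ℕ λ i → i < q × element i ≈ x
    element-surjective x with enum-surj x
    ... | k , k↦x with +-%-solve zero-index<q (Fin.toℕ<n k)
    ... | i , i<q , eq = i , i<q , trans (enum-index (Fin.toℕ<n k) eq) (trans (reflexive (≡.cong enum (Fin.fromℕ<-toℕ k _))) k↦x)

    digits : (m : ℕ) → ℕ → Fin m → Carrier
    digits (suc m) i Fin.zero    = element (i % q)
    digits (suc m) i (Fin.suc k) = digits m (i / q) k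

    digits-0 : ∀ m k → digits m 0 k ≈ 0#
    digits-0 (suc m) Fin.zero    = element-0
    digits-0 (suc m) (Fin.suc k) = digits-0 m k

    digits-injective : ∀ m {i j} → i < q ^ m → j < q ^ m → (∀ k → digits m i k ≈ digits m j k) → i ≡ j
    digits-injective zero {zero} {zero} _ _ _ = ≡.refl
    digits-injective zero {suc i} (s≤s ()) _ _
    digits-injective zero {zero} {suc j} _ (s≤s ()) _
    digits-injective (suc m) {i} {j} i<qᵐ⁺¹ j<qᵐ⁺¹ eq = begin
      i                        ≡⟨ m≡m%n+[m/n]*n i q ⟩
      i % q ℕ.+ i / q ℕ.* q    ≡⟨ ≡.cong₂ (λ r s → r ℕ.+ s ℕ.* q) low high ⟩
      j % q ℕ.+ j / q ℕ.* q    ≡⟨ m≡m%n+[m/n]*n j q ⟨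
      j                        ∎
      where
      open ≡.≡-Reasoning
      quotient< : ∀ {x} → x < q ^ suc m → x / q < q ^ m
      quotient< {x} x< = m<n*o⇒m/o<n (≡.subst (x <_) (ℕ.*-comm q (q ^ m)) x<)
      low : i % q ≡ j % q
      low = element-injective (m%n<n i q) (m%n<n j q) (eq Fin.zero)
      high : i / q ≡ j / q
      high = digits-injective m (quotient< i<qᵐ⁺¹) (quotient< j<qᵐ⁺¹) (λ k → eq (Fin.suc k))

    digits-surjective : ∀ m (u : Fin m → Carrier) → Σ ℕ λ i → i < q ^ m × (∀ k → digits m i k ≈ u k)
    digits-surjective zero u = 0 , s≤s z≤n , λ ()
    digits-surjective (suc m) u with element-surjective (u Fin.zero) | digits-surjective m (λ k → u (Fin.suc k))
    ... | r , r<q , r↦u₀ | s , s<qᵐ , s↦u = r ℕ.+ s ℕ.* q , bound , coordinates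
      where
      r%q : (r ℕ.+ s ℕ.* q) % q ≡ r
      r%q = ≡.trans ([m+kn]%n≡m%n r s q) (m<n⇒m%n≡m r<q)
      r/q : (r ℕ.+ s ℕ.* q) / q ≡ s
      r/q = ≡.trans (+-distrib-/ r (s ℕ.* q) remainders<q) (≡.cong₂ ℕ._+_ (m<n⇒m/n≡0 r<q) (m*n/n≡m s q))
        where
        remainders<q : r % q ℕ.+ (s ℕ.* q) % q < q
        remainders<q = ≡.subst (_< q) (≡.sym (≡.trans (≡.cong₂ ℕ._+_ (m<n⇒m%n≡m r<q) (m*n%n≡0 s q)) (ℕ.+-identityʳ r))) r<q
      bound : r ℕ.+ s ℕ.* q < q ^ suc m
      bound = ℕ.<-≤-trans (ℕ.+-monoˡ-< (s ℕ.* q) r<q)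
                (≡.subst (suc s ℕ.* q ℕ.≤_) (ℕ.*-comm (q ^ m) q) (ℕ.*-monoˡ-≤ q s<qᵐ))
      coordinates : ∀ k → digits (suc m) (r ℕ.+ s ℕ.* q) k ≈ u k
      coordinates Fin.zero    = trans (reflexive (≡.cong element r%q)) r↦u₀
      coordinates (Fin.suc k) = trans (reflexive (≡.cong (λ t → digits m t k) r/q)) (s↦u k)

module AffineGeometry {c ℓ : Level} (R : CommutativeRing c ℓ) (isField : IsField R) where

  open Fields using (module FieldProperties; module CommutativeRingIdentities)
  open import Level using (Lift; lift)
  open import Data.Fin using (suc)
  open import Data.Vec.Functional using (tail) renaming (_∷_ to _∷ᵥ_)
  open import Data.Product using (proj₁; proj₂)
  open import Data.Empty using (⊥)
  open import Relation.Nullary using (¬_)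

  open CommutativeRing R hiding (zero)
  open FieldProperties R isField
  open CommutativeRingIdentities R public
  open import Relation.Binary.Reasoning.Setoid setoid

  module _ {n : ℕ} where
    open Geometry R n public
      using (_≋_; _⊕_; _⊖_; _·_; NonZeroVec; aff; inf; LineSet; SameSet; IsAffineLine; Represents)

  Point : ℕ → Set c
  Point n = Geometry.Vec R n

  PG : ℕ → Set (c ⊔ ℓ)
  PG n = Geometry.PGPoint R n

  Subset : ℕ → Set (c ⊔ Level.suc (c ⊔ ℓ))
  Subset n = Point n → Set (c ⊔ ℓ)

  0ᵥ : ∀ {n} → Point n
  0ᵥ _ = 0#

  1∷≠0 : ∀ {n} (v : Point n) → NonZeroVec (1# ∷ᵥ v)
  1∷≠0 v 1v≋0 = 1≉0 (1v≋0 zero)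

  ≃-refl : ∀ {n} {L : Subset n} → SameSet L L
  ≃-refl y = (λ h → h) , (λ h → h)

  ≃-sym : ∀ {n} {L M : Subset n} → SameSet L M → SameSet M L
  ≃-sym L≃M y = proj₂ (L≃M y) , proj₁ (L≃M y)

  ≃-trans : ∀ {n} {L M N : Subset n} → SameSet L M → SameSet M N → SameSet L N
  ≃-trans L≃M M≃N y = (λ h → proj₁ (M≃N y) (proj₁ (L≃M y) h)) , (λ h → proj₂ (L≃M y) (proj₂ (M≃N y) h))

  LineSet-cong : ∀ {n} {x x′ d d′ : Point n} → x ≋ x′ → d ≋ d′ → SameSet (LineSet x d) (LineSet x′ d′)
  LineSet-cong x≋x′ d≋d′ y =
    (λ (t , y≋) → t , λ k → trans (y≋ k) (+-cong (x≋x′ k) (*-congˡ (d≋d′ k)))) ,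
    (λ (t , y≋) → t , λ k → trans (y≋ k) (sym (+-cong (x≋x′ k) (*-congˡ (d≋d′ k)))))

  -- If y = x + t d and e = μ d with μ ≠ 0, then x + s d = y + ((s - t) μ⁻¹) e and y + s e = x + (t + s μ) d.
  LineSet-reparam : ∀ {n} {x d y e : Point n} t μ → μ ≉ 0# → y ≋ (x ⊕ (t · d)) → e ≋ (μ · d) →
                    SameSet (LineSet x d) (LineSet y e)
  LineSet-reparam {x = x} {d} {y} {e} t μ μ≉0 y≋ e≋ w = to , from
    where
    ν = μ ⁻¹⟨ μ≉0 ⟩
    to : LineSet x d w → LineSet y e w
    to (s , w≋) = (s - t) * ν , λ k → begin
      w k                                   ≈⟨ w≋ k ⟩
      x k + s * d k                         ≈⟨ +-congˡ (*-congʳ (x+[y-x]≈y t s)) ⟨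
      x k + (t + (s - t)) * d k             ≈⟨ +-congˡ (distribʳ (d k) t (s - t)) ⟩
      x k + (t * d k + (s - t) * d k)       ≈⟨ +-assoc (x k) _ _ ⟨
      (x k + t * d k) + (s - t) * d k       ≈⟨ +-congˡ (*-congʳ (*-identityʳ (s - t))) ⟨
      (x k + t * d k) + ((s - t) * 1#) * d k          ≈⟨ +-congˡ (*-congʳ (*-congˡ (x⁻¹*x≈1 μ μ≉0))) ⟨
      (x k + t * d k) + ((s - t) * (ν * μ)) * d k     ≈⟨ +-congˡ (*-congʳ (*-assoc (s - t) ν μ)) ⟨
      (x k + t * d k) + (((s - t) * ν) * μ) * d k     ≈⟨ +-congˡ (*-assoc _ μ (d k)) ⟩
      (x k + t * d k) + ((s - t) * ν) * (μ * d k)     ≈⟨ +-cong (y≋ k) (*-congˡ (e≋ k)) ⟨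
      y k + ((s - t) * ν) * e k                       ∎
    from : LineSet y e w → LineSet x d w
    from (s , w≋) = t + s * μ , λ k → begin
      w k                                   ≈⟨ w≋ k ⟩
      y k + s * e k                         ≈⟨ +-cong (y≋ k) (*-congˡ (e≋ k)) ⟩
      (x k + t * d k) + s * (μ * d k)       ≈⟨ +-congˡ (*-assoc s μ (d k)) ⟨
      (x k + t * d k) + (s * μ) * d k       ≈⟨ +-assoc (x k) _ _ ⟩
      x k + (t * d k + (s * μ) * d k)       ≈⟨ +-congˡ (distribʳ (d k) t (s * μ)) ⟨
      x k + (t + s * μ) * d k               ∎

  ·-≋0 : ∀ {n} {μ} {d : Point n} → μ ≉ 0# → (μ · d) ≋ 0ᵥ → d ≋ 0ᵥ
  ·-≋0 μ≉0 μd≋0 k = *-cancelˡ-≈0 μ≉0 (μd≋0 k)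

  _≈ᴾ_ : ∀ {n} → PG n → PG n → Set ℓ
  aff x   ≈ᴾ aff y   = x ≋ y
  inf d _ ≈ᴾ inf e _ = d ≋ e
  _       ≈ᴾ _       = Lift ℓ ⊥

  PG-setoid : ℕ → Setoid (c ⊔ ℓ) ℓ
  PG-setoid n = record
    { Carrier = PG n
    ; _≈_ = _≈ᴾ_
    ; isEquivalence = record { refl = ≈ᴾ-refl ; sym = ≈ᴾ-sym ; trans = ≈ᴾ-trans }
    }
    where
    ≈ᴾ-refl : ∀ {p : PG n} → p ≈ᴾ p
    ≈ᴾ-refl {aff x}   k = refl
    ≈ᴾ-refl {inf d _} k = refl
    ≈ᴾ-sym : ∀ {p p′ : PG n} → p ≈ᴾ p′ → p′ ≈ᴾ p
    ≈ᴾ-sym {aff _}   {aff _}   x≋y k = sym (x≋y k)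
    ≈ᴾ-sym {inf _ _} {inf _ _} d≋e k = sym (d≋e k)
    ≈ᴾ-trans : ∀ {p p′ p″ : PG n} → p ≈ᴾ p′ → p′ ≈ᴾ p″ → p ≈ᴾ p″
    ≈ᴾ-trans {aff _}   {aff _}   {aff _}   x≋y y≋z k = trans (x≋y k) (y≋z k)
    ≈ᴾ-trans {inf _ _} {inf _ _} {inf _ _} d≋e e≋f k = trans (d≋e k) (e≋f k)

  Represents-respʳ : ∀ {n} {p p′ p″ : PG n} {L : Subset n} → p′ ≈ᴾ p″ → Represents p p′ L → Represents p p″ L
  Represents-respʳ {p = aff x}   {aff y}   {aff y′}  y≋y′ (x≉y , L≃) =
    (λ x≋y′ → x≉y (λ k → trans (x≋y′ k) (sym (y≋y′ k)))) ,
    ≃-trans L≃ (LineSet-cong (λ k → refl) (λ k → +-congʳ (y≋y′ k)))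
  Represents-respʳ {p = aff x}   {inf _ _} {inf _ _} d≋d′ L≃ = ≃-trans L≃ (LineSet-cong (λ k → refl) d≋d′)
  Represents-respʳ {p = inf _ _} {aff y}   {aff y′}  y≋y′ L≃ = ≃-trans L≃ (LineSet-cong y≋y′ (λ k → refl))
  Represents-respʳ {p = inf _ _} {inf _ _} {inf _ _} _ (lift ())

  Represents-≃ : ∀ {n} {p p′ : PG n} {L M : Subset n} → Represents p p′ L → SameSet L M → Represents p p′ M
  Represents-≃ {p = aff _}   {aff _}   (x≉y , L≃) L≃M = x≉y , ≃-trans (≃-sym L≃M) L≃
  Represents-≃ {p = aff _}   {inf _ _} L≃ L≃M         = ≃-trans (≃-sym L≃M) L≃
  Represents-≃ {p = inf _ _} {aff _}   L≃ L≃M         = ≃-trans (≃-sym L≃M) L≃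
  Represents-≃ {p = inf _ _} {inf _ _} (lift ())

  Represents-unique : ∀ {n} {p p′ : PG n} {L M : Subset n} → Represents p p′ L → Represents p p′ M → SameSet L M
  Represents-unique {p = aff _}   {aff _}   (_ , L≃) (_ , M≃) = ≃-trans L≃ (≃-sym M≃)
  Represents-unique {p = aff _}   {inf _ _} L≃ M≃             = ≃-trans L≃ (≃-sym M≃)
  Represents-unique {p = inf _ _} {aff _}   L≃ M≃             = ≃-trans L≃ (≃-sym M≃)
  Represents-unique {p = inf _ _} {inf _ _} (lift ())

  represents-aff-inf : ∀ {n} {x d y e : Point n} {e≠0} t μ → μ ≉ 0# → y ≋ (x ⊕ (t · d)) → e ≋ (μ · d) →
                       Represents (aff y) (inf e e≠0) (LineSet x d)
  represents-aff-inf = LineSet-reparam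

  represents-inf-aff : ∀ {n} {x d y e : Point n} {e≠0} t μ → μ ≉ 0# → y ≋ (x ⊕ (t · d)) → e ≋ (μ · d) →
                       Represents (inf e e≠0) (aff y) (LineSet x d)
  represents-inf-aff = LineSet-reparam

  represents-aff-aff : ∀ {n} {x d y y′ : Point n} t t′ → NonZeroVec d → t′ - t ≉ 0# →
                       y ≋ (x ⊕ (t · d)) → y′ ≋ (x ⊕ (t′ · d)) → Represents (aff y) (aff y′) (LineSet x d)
  represents-aff-aff {x = x} {d} {y} {y′} t t′ d≠0 t′-t≉0 y≋ y′≋ =
    y≉y′ , LineSet-reparam t (t′ - t) t′-t≉0 y≋ y′-y≋
    where
    y′-y≋ : (y′ ⊖ y) ≋ ((t′ - t) · d)
    y′-y≋ k = trans (+-cong (y′≋ k) (-‿cong (y≋ k))) ([x+sd]-[x+td]≈[s-t]d (x k) t′ t (d k))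
    y≉y′ : ¬ (y ≋ y′)
    y≉y′ y≋y′ = d≠0 (·-≋0 t′-t≉0 (λ k → trans (sym (y′-y≋ k)) (trans (+-congʳ (sym (y≋y′ k))) (-‿inverseʳ (y k)))))

  SameLine : ∀ {n} → Point n → Point n → Point n → Point n → Set (c ⊔ ℓ)
  SameLine x d X D = ∃[ λ′ ] ∃[ μ ] (λ′ ≉ 0# × D ≋ (λ′ · d) × X ≋ (x ⊕ (μ · d)))

  SameLine⇒≃ : ∀ {n} {x d X D : Point n} → SameLine x d X D → SameSet (LineSet x d) (LineSet X D)
  SameLine⇒≃ (λ′ , μ , λ′≉0 , D≋ , X≋) = LineSet-reparam μ λ′ λ′≉0 X≋ D≋

  ≃⇒SameLine : ∀ {n} {x d X D : Point n} → NonZeroVec D → SameSet (LineSet x d) (LineSet X D) → SameLine x d X D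
  ≃⇒SameLine {x = x} {d} {X} {D} D≠0 L≃
    with proj₂ (L≃ X) (0# , λ k → sym (trans (+-congˡ (zeroˡ (D k))) (+-identityʳ (X k))))
       | proj₂ (L≃ (X ⊕ D)) (1# , λ k → +-congˡ (sym (*-identityˡ (D k))))
  ... | μ , X≋ | ν , X+D≋ = ν - μ , μ , ν-μ≉0 , D≋ , X≋
    where
    D≋ : D ≋ ((ν - μ) · d)
    D≋ k = begin
      D k                                ≈⟨ [x+y]-x≈y (X k) (D k) ⟨
      (X k + D k) - X k                  ≈⟨ +-cong (X+D≋ k) (-‿cong (X≋ k)) ⟩
      (x k + ν * d k) - (x k + μ * d k)  ≈⟨ [x+sd]-[x+td]≈[s-t]d (x k) ν μ (d k) ⟩
      (ν - μ) * d k                      ∎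
    ν-μ≉0 : ν - μ ≉ 0#
    ν-μ≉0 ν-μ≈0 = D≠0 (λ k → trans (D≋ k) (trans (*-congʳ ν-μ≈0) (zeroˡ (d k))))

  embed : ∀ {n} → Carrier → PG n → PG (suc n)
  embed a (aff u)       = aff (a ∷ᵥ u)
  embed a (inf d d≠0)   = inf (0# ∷ᵥ d) (λ 0d≋0 → d≠0 (λ k → 0d≋0 (suc k)))

  embed-cong : ∀ {n} a {p p′ : PG n} → p ≈ᴾ p′ → embed a p ≈ᴾ embed a p′
  embed-cong a {aff _}   {aff _}   _   zero    = refl
  embed-cong a {aff _}   {aff _}   x≋y (suc k) = x≋y k
  embed-cong a {inf _ _} {inf _ _} _   zero    = refl
  embed-cong a {inf _ _} {inf _ _} d≋e (suc k) = d≋e k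

  LineSet-embed : ∀ {n} a {x d y e : Point n} → SameSet (LineSet x d) (LineSet y e) →
                  SameSet (LineSet (a ∷ᵥ x) (0# ∷ᵥ d)) (LineSet (a ∷ᵥ y) (0# ∷ᵥ e))
  LineSet-embed a L≃ w = lift-⊆ (λ v → proj₁ (L≃ v)) , lift-⊆ (λ v → proj₂ (L≃ v))
    where
    lift-⊆ : ∀ {x d y e} → (∀ v → LineSet x d v → LineSet y e v) →
             LineSet (a ∷ᵥ x) (0# ∷ᵥ d) w → LineSet (a ∷ᵥ y) (0# ∷ᵥ e) w
    lift-⊆ ⊆ (t , w≋) with ⊆ (tail w) (t , λ k → w≋ (suc k))
    ... | t′ , w≋′ = t′ , λ where
      zero    → trans (w≋ zero) (trans (x+t*0≈x a t) (sym (x+t*0≈x a t′)))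
      (suc k) → w≋′ k

  Represents-embed : ∀ {n} a {p p′ : PG n} {X D : Point n} → Represents p p′ (LineSet X D) →
                     Represents (embed a p) (embed a p′) (LineSet (a ∷ᵥ X) (0# ∷ᵥ D))
  Represents-embed a {aff x}   {aff y}   (x≉y , L≃) =
    (λ ax≋ay → x≉y (λ k → ax≋ay (suc k))) ,
    ≃-trans (LineSet-embed a L≃) (LineSet-cong (λ k → refl) direction)
    where
    direction : (0# ∷ᵥ (y ⊖ x)) ≋ ((a ∷ᵥ y) ⊖ (a ∷ᵥ x))
    direction zero    = sym (-‿inverseʳ a)
    direction (suc k) = refl
  Represents-embed a {aff _}   {inf _ _} L≃ = LineSet-embed a L≃
  Represents-embed a {inf _ _} {aff _}   L≃ = LineSet-embed a L≃
  Represents-embed a {inf _ _} {inf _ _} (lift ())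

module Codes where
  open Lists
  open Fields
  open import Data.Nat as ℕ using (ℕ; zero; suc; _<_; _^_; pred; z≤n)
  import Data.Nat.Properties as ℕ
  open import Data.Nat.DivMod using (_%_; m%n<n)
  open import Data.Fin using (suc)
  open import Data.Vec.Functional using (tail) renaming (_∷_ to _∷ᵥ_)
  open import Data.List using (List; []; _∷_; _++_; cartesianProductWith)
  open import Data.List.Membership.Propositional using (_∈_)
  open import Data.List.Membership.Propositional.Properties using (∈-cartesianProductWith⁺; ∈-cartesianProductWith⁻; ∈-++⁺ˡ; ∈-++⁺ʳ; ∈-++⁻)
  open import Data.List.Relation.Unary.Any using (here)
  import Data.List.Relation.Unary.All as All
  open import Data.List.Relation.Unary.Unique.Propositional using (Unique; []; _∷_)
  import Data.List.Relation.Unary.Unique.Propositional.Properties as Unique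
  open import Data.Product using (proj₁; proj₂)
  open import Data.Sum using (inj₁; inj₂)
  open import Data.Unit using (⊤; tt)
  open import Relation.Nullary using (¬_; yes; no)
  open import Relation.Binary.PropositionalEquality as ≡ using (_≡_)

  -- Code m names a line of F^(1+m). In F¹ there is a single line; a line of F^(2+m) either lies in
  -- a hyperplane x₀ = a (within a κ), or meets x₀ = 0 in a unique point (0 , u) and has a unique
  -- direction (1 , v). In the second case u and v are the vectors with digits i and (i + d) mod q^(1+m):
  -- the lines with a fixed difference d form one orbit of the cyclic shift i ↦ i + 1.
  data Code : ℕ → Set where
    whole  : Code 0
    across : ∀ {m} (i d : ℕ) → Code (suc m)
    within : ∀ {m} (a : ℕ) → Code m → Code (suc m)

  module LineCodes {c ℓ : Level} (R : CommutativeRing c ℓ) (isField : IsField R) (q₀ : ℕ)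
    (card : HasCardinality R (suc (suc q₀))) where

    open CommutativeRing R hiding (zero)
    open FieldProperties R isField
    open FiniteField R isField q₀ card public
    open AffineGeometry R isField public
    open import Relation.Binary.Reasoning.Setoid setoid

    q : ℕ
    q = suc (suc q₀)

    -- Q m = q^(1+m), written as a successor so that Modular (Q′ m) applies.
    Q′ : ℕ → ℕ
    Q′ m = pred (q ^ suc m)

    Q : ℕ → ℕ
    Q m = suc (Q′ m)

    Q≡q^[1+m] : ∀ m → Q m ≡ q ^ suc m
    Q≡q^[1+m] m = ℕ.suc-pred (q ^ suc m) {{ℕ.m^n≢0 q (suc m)}}

    vector : ∀ m → ℕ → Point (suc m)
    vector m = digits (suc m)

    vector-injective : ∀ m {i j} → i < Q m → j < Q m → vector m i ≋ vector m j → i ≡ j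
    vector-injective m {i} {j} i<Q j<Q =
      digits-injective (suc m) (≡.subst (i <_) (Q≡q^[1+m] m) i<Q) (≡.subst (j <_) (Q≡q^[1+m] m) j<Q)

    vector-surjective : ∀ m (u : Point (suc m)) → Σ ℕ λ i → i < Q m × vector m i ≋ u
    vector-surjective m u with digits-surjective (suc m) u
    ... | i , i< , i↦u = i , ≡.subst (i <_) (≡.sym (Q≡q^[1+m] m)) i< , i↦u

    Valid : ∀ {m} → Code m → Set
    Valid whole                = ⊤
    Valid {suc m} (across i d) = i < Q m × d < Q m
    Valid (within a κ)         = a < q × Valid κ

    origin : ∀ {m} → Code m → Point (suc m)
    origin whole                = 0ᵥ
    origin {suc m} (across i d) = 0# ∷ᵥ vector m i
    origin (within a κ)         = element a ∷ᵥ origin κ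

    direction : ∀ {m} → Code m → Point (suc m)
    direction whole                = λ _ → 1#
    direction {suc m} (across i d) = 1# ∷ᵥ vector m ((i ℕ.+ d) % Q m)
    direction (within a κ)         = 0# ∷ᵥ direction κ

    lineOf : ∀ {m} → Code m → Subset (suc m)
    lineOf κ = LineSet (origin κ) (direction κ)

    direction≠0 : ∀ {m} (κ : Code m) → NonZeroVec (direction κ)
    direction≠0 whole        d≋0 = 1≉0 (d≋0 zero)
    direction≠0 (across i d) d≋0 = 1≉0 (d≋0 zero)
    direction≠0 (within a κ) d≋0 = direction≠0 κ (λ k → d≋0 (suc k))

    private
      -- Scaling by d₀⁻¹ and moving by - x₀ d₀⁻¹ brings a line with d₀ ≠ 0 to the form (0 , _) + ⟨(1 , _)⟩.
      normalise : ∀ x₀ d₀ (d₀≉0 : d₀ ≉ 0#) → 0# ≈ x₀ + (- x₀ * d₀ ⁻¹⟨ d₀≉0 ⟩) * d₀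
      normalise x₀ d₀ d₀≉0 = sym (begin
        x₀ + (- x₀ * d₀ ⁻¹⟨ d₀≉0 ⟩) * d₀    ≈⟨ +-congˡ (*-assoc _ _ _) ⟩
        x₀ + - x₀ * (d₀ ⁻¹⟨ d₀≉0 ⟩ * d₀)    ≈⟨ +-congˡ (*-congˡ (x⁻¹*x≈1 d₀ d₀≉0)) ⟩
        x₀ + - x₀ * 1#                     ≈⟨ +-congˡ (*-identityʳ _) ⟩
        x₀ - x₀                            ≈⟨ -‿inverseʳ x₀ ⟩
        0#                                 ∎)

    code-exists : ∀ m (x d : Point (suc m)) → NonZeroVec d → Σ (Code m) λ κ → Valid κ × SameLine x d (origin κ) (direction κ)
    code-exists zero x d d≠0 = whole , tt , λ′ , μ , x⁻¹≉0 (d zero) d₀≉0 , D≋ , X≋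
      where
      d₀≉0 : d zero ≉ 0#
      d₀≉0 d₀≈0 = d≠0 (λ { zero → d₀≈0 })
      λ′ = d zero ⁻¹⟨ d₀≉0 ⟩
      μ = - x zero * λ′
      D≋ : direction whole ≋ (λ′ · d)
      D≋ zero = sym (x⁻¹*x≈1 (d zero) d₀≉0)
      X≋ : origin whole ≋ (x ⊕ (μ · d))
      X≋ zero = normalise (x zero) (d zero) d₀≉0
    code-exists (suc m) x d d≠0 with d zero ≈? 0#
    ... | no d₀≉0 = across i δ , (i<Q , δ<Q) , λ′ , μ , x⁻¹≉0 (d zero) d₀≉0 , D≋ , X≋
      where
      open Modular (Q′ m) using (+-%-solve)
      λ′ = d zero ⁻¹⟨ d₀≉0 ⟩
      μ = - x zero * λ′
      u = vector-surjective m (tail (x ⊕ (μ · d)))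
      v = vector-surjective m (tail (λ′ · d))
      i = proj₁ u
      i<Q = proj₁ (proj₂ u)
      δ = proj₁ (+-%-solve i<Q (proj₁ (proj₂ v)))
      δ<Q = proj₁ (proj₂ (+-%-solve i<Q (proj₁ (proj₂ v))))
      D≋ : direction (across {m} i δ) ≋ (λ′ · d)
      D≋ zero    = sym (x⁻¹*x≈1 (d zero) d₀≉0)
      D≋ (suc k) = trans (reflexive (≡.cong (λ t → vector m t k) (proj₂ (proj₂ (+-%-solve i<Q (proj₁ (proj₂ v)))))))
                         (proj₂ (proj₂ v) k)
      X≋ : origin (across {m} i δ) ≋ (x ⊕ (μ · d))
      X≋ zero    = normalise (x zero) (d zero) d₀≉0
      X≋ (suc k) = proj₂ (proj₂ u) k
    ... | yes d₀≈0 with code-exists m (tail x) (tail d) (λ d′≋0 → d≠0 (λ { zero → d₀≈0 ; (suc k) → d′≋0 k }))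
    ...   | κ , κ-valid , λ′ , μ , λ′≉0 , D≋ , X≋ with element-surjective (x zero)
    ...     | a , a<q , a↦x₀ = within a κ , (a<q , κ-valid) , λ′ , μ , λ′≉0 , D≋′ , X≋′
      where
      D≋′ : direction (within a κ) ≋ (λ′ · d)
      D≋′ zero    = sym (trans (*-congˡ d₀≈0) (zeroʳ λ′))
      D≋′ (suc k) = D≋ k
      X≋′ : origin (within a κ) ≋ (x ⊕ (μ · d))
      X≋′ zero    = trans a↦x₀ (sym (trans (+-congˡ (*-congˡ d₀≈0)) (x+t*0≈x (x zero) μ)))
      X≋′ (suc k) = X≋ k

    code-unique : ∀ {m} (κ κ′ : Code m) → Valid κ → Valid κ′ →
                  SameLine (origin κ) (direction κ) (origin κ′) (direction κ′) → κ ≡ κ′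
    code-unique whole whole _ _ _ = ≡.refl
    code-unique {suc m} (across i d) (across i′ d′) (i<Q , d<Q) (i′<Q , d′<Q) (λ′ , μ , _ , D≋ , X≋) =
      ≡.cong₂ across i≡i′ d≡d′
      where
      open Modular (Q′ m) using (+-%-cancelˡ)
      λ′≈1 : λ′ ≈ 1#
      λ′≈1 = trans (sym (*-identityʳ λ′)) (sym (D≋ zero))
      μ≈0 : μ ≈ 0#
      μ≈0 = trans (sym (*-identityʳ μ)) (trans (sym (+-identityˡ _)) (sym (X≋ zero)))
      i≡i′ : i ≡ i′
      i≡i′ = vector-injective m i<Q i′<Q (λ k → sym (trans (X≋ (suc k)) (trans (+-congˡ (trans (*-congʳ μ≈0) (zeroˡ _))) (+-identityʳ _))))
      i+d≡i′+d′ : (i ℕ.+ d) % Q m ≡ (i′ ℕ.+ d′) % Q m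
      i+d≡i′+d′ = vector-injective m (m%n<n (i ℕ.+ d) (Q m)) (m%n<n (i′ ℕ.+ d′) (Q m))
                    (λ k → sym (trans (D≋ (suc k)) (trans (*-congʳ λ′≈1) (*-identityˡ _))))
      d≡d′ : d ≡ d′
      d≡d′ = +-%-cancelˡ i d<Q d′<Q (≡.trans i+d≡i′+d′ (≡.cong (λ t → (t ℕ.+ d′) % Q m) (≡.sym i≡i′)))
    code-unique (across _ _) (within _ _) _ _ (λ′ , _ , λ′≉0 , D≋ , _) = ⊥-elim (λ′≉0 (trans (sym (*-identityʳ λ′)) (sym (D≋ zero))))
    code-unique (within _ _) (across _ _) _ _ (λ′ , _ , _ , D≋ , _) = ⊥-elim (1≉0 (trans (D≋ zero) (zeroʳ λ′)))
    code-unique (within a κ) (within a′ κ′) (a<q , κ-valid) (a′<q , κ′-valid) (λ′ , μ , λ′≉0 , D≋ , X≋) =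
      ≡.cong₂ within a≡a′ (code-unique κ κ′ κ-valid κ′-valid (λ′ , μ , λ′≉0 , (λ k → D≋ (suc k)) , (λ k → X≋ (suc k))))
      where
      a≡a′ : a ≡ a′
      a≡a′ = element-injective a<q a′<q (sym (trans (X≋ zero) (x+t*0≈x _ μ)))

    transversals : ∀ m → List (Code (suc m))
    transversals m = cartesianProductWith (λ d i → across i d) (interval 0 (Q m)) (interval 0 (Q m))

    allCodes : ∀ m → List (Code m)
    allCodes zero    = whole ∷ []
    allCodes (suc m) = transversals m ++ cartesianProductWith within (interval 0 q) (allCodes m)

    Valid⇒∈-allCodes : ∀ {m} (κ : Code m) → Valid κ → κ ∈ allCodes m
    Valid⇒∈-allCodes whole _ = here ≡.refl
    Valid⇒∈-allCodes {suc m} (across i d) (i<Q , d<Q) =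
      ∈-++⁺ˡ (∈-cartesianProductWith⁺ (λ d i → across i d) (∈-interval⁺ z≤n d<Q) (∈-interval⁺ z≤n i<Q))
    Valid⇒∈-allCodes {suc m} (within a κ) (a<q , κ-valid) =
      ∈-++⁺ʳ (transversals m) (∈-cartesianProductWith⁺ within (∈-interval⁺ z≤n a<q) (Valid⇒∈-allCodes κ κ-valid))

    ∈-allCodes⇒Valid : ∀ {m} {κ : Code m} → κ ∈ allCodes m → Valid κ
    ∈-allCodes⇒Valid {zero} (here ≡.refl) = tt
    ∈-allCodes⇒Valid {suc m} κ∈ with ∈-++⁻ (transversals m) κ∈
    ... | inj₁ κ∈ᵗ with ∈-cartesianProductWith⁻ (λ d i → across i d) (interval 0 (Q m)) (interval 0 (Q m)) κ∈ᵗ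
    ...   | d , i , d∈ , i∈ , ≡.refl = proj₂ (∈-interval⁻ i∈) , proj₂ (∈-interval⁻ d∈)
    ∈-allCodes⇒Valid {suc m} κ∈ | inj₂ κ∈ʷ with ∈-cartesianProductWith⁻ within (interval 0 q) (allCodes m) κ∈ʷ
    ...   | a , κ , a∈ , κ∈′ , ≡.refl = proj₂ (∈-interval⁻ a∈) , ∈-allCodes⇒Valid κ∈′

    allCodes-unique : ∀ m → Unique (allCodes m)
    allCodes-unique zero    = All.[] ∷ []
    allCodes-unique (suc m) = Unique.++⁺
      (Unique.cartesianProductWith⁺ (λ d i → across i d) (λ { ≡.refl → ≡.refl , ≡.refl }) (interval-unique 0 (Q m)) (interval-unique 0 (Q m)))
      (Unique.cartesianProductWith⁺ within (λ { ≡.refl → ≡.refl , ≡.refl }) (interval-unique 0 q) (allCodes-unique m))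
      across≢within
      where
      across≢within : ∀ {κ} → ¬ (κ ∈ transversals m × κ ∈ cartesianProductWith within (interval 0 q) (allCodes m))
      across≢within (κ∈ᵗ , κ∈ʷ)
        with ∈-cartesianProductWith⁻ (λ d i → across i d) (interval 0 (Q m)) (interval 0 (Q m)) κ∈ᵗ
           | ∈-cartesianProductWith⁻ within (interval 0 q) (allCodes m) κ∈ʷ
      ... | _ , _ , _ , _ , ≡.refl | _ , _ , _ , _ , ()

module TransversalWalks {c ℓ : Level} (R : CommutativeRing c ℓ) (isField : IsField R) (q₀ : ℕ)
  (card : HasCardinality R (suc (suc q₀))) where

  open Lists
  open Fields
  open Codes
  open import Data.Nat as ℕ using (ℕ; zero; suc; pred; _<_; _≤_; z≤n; s≤s)
  import Data.Nat.Properties as ℕ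
  open import Data.Nat.DivMod using (_%_; m<n⇒m%n≡m; n%n≡0; [m+n]%n≡m%n)
  open import Data.Fin using (suc)
  open import Data.Vec.Functional using () renaming (_∷_ to _∷ᵥ_)
  open import Data.List using (List; []; _∷_; _++_; map; concatMap)
  open import Data.List.Properties using (map-concatMap; map-∘; map-++; concatMap-++; concatMap-cong)
  open import Data.List.Relation.Binary.Pointwise using (Pointwise; []; _∷_)
  open import Data.List.Relation.Binary.Permutation.Propositional
    using (_↭_; ↭-refl; ↭-trans; prep; swap; module PermutationReasoning)
  open import Data.List.Relation.Binary.Permutation.Propositional.Properties using (++⁺; ++⁺ʳ; ++-comm; map⁺)
  open import Data.Product using (proj₂)
  open import Data.List.Relation.Unary.Any using (here)
  open import Relation.Binary.PropositionalEquality as ≡ using (_≡_)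

  open CommutativeRing R hiding (zero)
  open FieldProperties R isField
  open LineCodes R isField q₀ card hiding (Q) public

  module Walks (m : ℕ) = ClosedWalks (PG-setoid (suc m)) (λ p p′ κ → Represents p p′ (lineOf {m} κ)) Represents-respʳ

  module Transversal (m : ℕ) where

    open Modular (Q′ m) public
    open Walks (suc m) public

    Window : PG (suc (suc m)) → PG (suc (suc m)) → Code (suc m) → Set _
    Window p p′ κ = Represents p p′ (lineOf κ)

    A : ℕ → PG (suc (suc m))
    A i = aff (0# ∷ᵥ vector m i)

    I : ℕ → PG (suc (suc m))
    I u = inf (1# ∷ᵥ vector m u) (1∷≠0 (vector m u))

    A0≈origin : A 0 ≈ᴾ aff 0ᵥ
    A0≈origin zero    = refl
    A0≈origin (suc k) = digits-0 (suc m) k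

    point : ℕ → ℕ → Carrier → PG (suc (suc m))
    point i j t = aff (t ∷ᵥ (vector m i ⊕ (t · vector m j)))

    D : ℕ → List (Code (suc m))
    D d = map (λ i → across i d) (interval 0 Q)

    transversals≡concatMap-D : transversals m ≡ concatMap D (interval 0 Q)
    transversals≡concatMap-D = cartesianProductWith-concatMap (λ d i → across i d) (interval 0 Q) (interval 0 Q)

    A-I : ∀ {i d u} → (i ℕ.+ d) % Q ≡ u → Window (A i) (I u) (across i d)
    A-I ≡.refl = ≃-refl

    I-A : ∀ {i d u} → (i ℕ.+ d) % Q ≡ u → Window (I u) (A i) (across i d)
    I-A ≡.refl = ≃-refl

    private
      point-on-line : ∀ {i d} t → (t ∷ᵥ (vector m i ⊕ (t · vector m ((i ℕ.+ d) % Q))))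
                                   ≋ (origin (across {m} i d) ⊕ (t · direction (across {m} i d)))
      point-on-line t zero    = sym (trans (+-identityˡ _) (*-identityʳ t))
      point-on-line t (suc k) = refl

      I≋1·direction : ∀ {i d u} → (i ℕ.+ d) % Q ≡ u → (1# ∷ᵥ vector m u) ≋ (1# · direction (across {m} i d))
      I≋1·direction ≡.refl k = sym (*-identityˡ _)

    I-point : ∀ {i d u} t → (i ℕ.+ d) % Q ≡ u → Window (I u) (point i ((i ℕ.+ d) % Q) t) (across i d)
    I-point {i} {d} t i+d≡u = represents-inf-aff {e≠0 = 1∷≠0 _} t 1# 1≉0 (point-on-line {i} {d} t) (I≋1·direction {i} {d} i+d≡u)

    point-I : ∀ {i d u} t → (i ℕ.+ d) % Q ≡ u → Window (point i ((i ℕ.+ d) % Q) t) (I u) (across i d)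
    point-I {i} {d} t i+d≡u = represents-aff-inf {e≠0 = 1∷≠0 _} t 1# 1≉0 (point-on-line {i} {d} t) (I≋1·direction {i} {d} i+d≡u)

    point-A : ∀ {i d t} → t ≉ 0# → Window (point i ((i ℕ.+ d) % Q) t) (A i) (across i d)
    point-A {i} {d} {t} t≉0 = represents-aff-aff t 0# (direction≠0 (across i d)) 0-t≉0 (point-on-line {i} {d} t) A-on-line
      where
      A-on-line : (0# ∷ᵥ vector m i) ≋ (origin (across {m} i d) ⊕ (0# · direction (across {m} i d)))
      A-on-line zero    = sym (trans (+-identityˡ _) (zeroˡ _))
      A-on-line (suc k) = sym (trans (+-congˡ (zeroˡ _)) (+-identityʳ _))
      0-t≉0 : 0# - t ≉ 0#
      0-t≉0 = x-y≉0 (λ 0≈t → t≉0 (sym 0≈t))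

    shifted-class : ∀ d → map (λ i → across (suc i % Q) d) (interval 0 Q) ↭ D d
    shifted-class d = begin
      map (λ i → across (suc i % Q) d) (interval 0 Q)                    ≡⟨ map-∘ (interval 0 Q) ⟩
      map (λ i → across i d) (map (λ i → suc i % Q) (interval 0 Q))      ↭⟨ map⁺ (λ i → across i d) map-suc-%-interval ⟩
      D d                                                                ∎
      where open PermutationReasoning

    Column : (ℕ → Code (suc m)) → ℕ → Set _
    Column f d = map f (interval 0 Q) ↭ D d

    columns-↭ : ∀ {cols ds} → Pointwise Column cols ds → concatMap (λ f → map f (interval 0 Q)) cols ↭ concatMap D ds
    columns-↭ []                 = ↭-refl
    columns-↭ (column ∷ columns) = ++⁺ column (columns-↭ columns)

    A-I-0 : ∀ {i} → i < Q → Window (A i) (I i) (across i 0)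
    A-I-0 {i} i<Q = A-I (≡.trans (≡.cong (_% Q) (ℕ.+-identityʳ i)) (m<n⇒m%n≡m i<Q))

    A-next : ∀ {i} → suc i < Q → A (suc i % Q) ≡ A (suc i)
    A-next 1+i<Q = ≡.cong A (m<n⇒m%n≡m 1+i<Q)

    A-wrap : ∀ {i} → suc i ≡ Q → A (suc i % Q) ≡ A 0
    A-wrap 1+i≡Q = ≡.cong A (≡.trans (≡.cong (_% Q) 1+i≡Q) (n%n≡0 Q))

    I-A-suc : ∀ i d {z} → A (suc i % Q) ≡ z → Window (I ((i ℕ.+ suc d) % Q)) z (across (suc i % Q) d)
    I-A-suc i d ≡.refl = I-A (suc-%-+ i d)

    -- A 0 → I (1+e) → A 1 → I (2+e) → ⋯ alternates between the classes D (1+e) and D e.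
    zigzag-block : ℕ → ℕ → Walk
    zigzag-block e i = (A i , across i (suc e)) ∷ (I ((i ℕ.+ suc e) % Q) , across (suc i % Q) e) ∷ []

    zigzag : ℕ → Walk
    zigzag e = concatMap (zigzag-block e) (interval 0 Q)

    zigzag-block-steps : ∀ e i {z} → A (suc i % Q) ≡ z → Steps (zigzag-block e i) z
    zigzag-block-steps e i A-next≡z = A-I ≡.refl , I-A-suc i e A-next≡z , _

    zigzag-loop : ∀ e → IsLoopAt (A 0) (zigzag e)
    zigzag-loop e = ≡.refl , Steps-blocks (zigzag-block e) A (λ _ _ → ≡.refl) 0 (Q′ m)
      (λ i _ i<Q′ → zigzag-block-steps e i (A-next (s≤s i<Q′))) (zigzag-block-steps e (Q′ m) (A-wrap ≡.refl))

    labels-zigzag : ∀ e → labels (zigzag e) ↭ concatMap D (with-suc e)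
    labels-zigzag e = ↭-trans (labels-blocks (zigzag-block e) _ (λ _ → ≡.refl) (interval 0 Q)) (columns-↭ (↭-refl ∷ shifted-class e ∷ []))

    zigzags : List ℕ → Walk
    zigzags = concatMap zigzag

    zigzags-loop : ∀ es → IsLoopAt (A 0) (zigzags es)
    zigzags-loop = loop-concatMap zigzag zigzag-loop

    labels-zigzags : ∀ es → labels (zigzags es) ↭ concatMap D (concatMap with-suc es)
    labels-zigzags es = begin
      labels (zigzags es)                              ≡⟨ map-concatMap proj₂ zigzag es ⟩
      concatMap (λ e → labels (zigzag e)) es           ↭⟨ concatMap-cong-↭ labels-zigzag es ⟩
      concatMap (λ e → concatMap D (with-suc e)) es    ≡⟨ concatMap-concatMap D with-suc es ⟨
      concatMap D (concatMap with-suc es)              ∎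
      where open PermutationReasoning

    Y : ℕ → PG (suc (suc m))
    Y i = point i ((i ℕ.+ 1) % Q) 1#

    suc-%-+-Q′ : ∀ {i} → i < Q → (suc i % Q ℕ.+ Q′ m) % Q ≡ i
    suc-%-+-Q′ {i} i<Q = ≡.trans (suc-%-+ i (Q′ m)) (≡.trans ([m+n]%n≡m%n i Q) (m<n⇒m%n≡m i<Q))

    private

      Y≈ : ∀ {i} → i < Q → point (suc i % Q) ((suc i % Q ℕ.+ Q′ m) % Q) 1# ≈ᴾ Y i
      Y≈ i<Q zero    = refl
      Y≈ {i} i<Q (suc k) = begin
        vector m (suc i % Q) k + 1# * vector m ((suc i % Q ℕ.+ Q′ m) % Q) k
          ≈⟨ +-cong (reflexive (≡.cong (λ j → vector m (j % Q) k) (ℕ.+-comm 1 i)))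
                    (*-congˡ (reflexive (≡.cong (λ j → vector m j k) (suc-%-+-Q′ i<Q)))) ⟩
        vector m ((i ℕ.+ 1) % Q) k + 1# * vector m i k                      ≈⟨ +-congˡ (*-identityˡ _) ⟩
        vector m ((i ℕ.+ 1) % Q) k + vector m i k                           ≈⟨ +-comm _ _ ⟩
        vector m i k + vector m ((i ℕ.+ 1) % Q) k                           ≈⟨ +-congˡ (*-identityˡ _) ⟨
        vector m i k + 1# * vector m ((i ℕ.+ 1) % Q) k                      ∎
        where open import Relation.Binary.Reasoning.Setoid setoid

    I-Y : ∀ {i} → i < Q → Window (I i) (Y i) (across (suc i % Q) (Q′ m))
    I-Y {i} i<Q =
      Represents-respʳ {p = I i} {p′ = point (suc i % Q) ((suc i % Q ℕ.+ Q′ m) % Q) 1#} {p″ = Y i}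
                       {L = lineOf (across {m} (suc i % Q) (Q′ m))}
        (Y≈ i<Q) (I-point {suc i % Q} {Q′ m} 1# (suc-%-+-Q′ i<Q))

    -- Y i lies both on A (1+i) + ⟨I i⟩ and on A i + ⟨I (1+i)⟩, so the blocks A i → I i → Y i → A i → I (i+3) → A (1+i)
    -- cover the five classes D 0, D (Q-1), D 1, D 3, D 2.
    triangle-block : ℕ → Walk
    triangle-block i = (A i , across i 0) ∷ (I i , across (suc i % Q) (Q′ m)) ∷ (Y i , across i 1)
                     ∷ (A i , across i 3) ∷ (I ((i ℕ.+ 3) % Q) , across (suc i % Q) 2) ∷ []

    triangles : Walk
    triangles = concatMap triangle-block (interval 0 Q)

    triangles-loop : IsLoopAt (A 0) triangles
    triangles-loop = ≡.refl , Steps-blocks triangle-block A (λ _ _ → ≡.refl) 0 (Q′ m) inner last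
      where
      to-next : ∀ i {z} → i < Q → A (suc i % Q) ≡ z → Steps (triangle-block i) z
      to-next i i<Q A-next≡z =
        A-I-0 i<Q , I-Y i<Q , point-A {i} {1} 1≉0 , A-I {i} {3} ≡.refl , I-A-suc i 2 A-next≡z , _
      inner : ∀ i → 0 ≤ i → i < Q′ m → Steps (triangle-block i) (A (suc i))
      inner i _ i<Q′ = to-next i (ℕ.m<n⇒m<1+n i<Q′) (A-next (s≤s i<Q′))
      last : Steps (triangle-block (Q′ m)) (A 0)
      last = to-next (Q′ m) ℕ.≤-refl (A-wrap ≡.refl)

    labels-triangles : labels triangles ↭ concatMap D (0 ∷ Q′ m ∷ 1 ∷ 3 ∷ 2 ∷ [])
    labels-triangles = ↭-trans (labels-blocks triangle-block _ (λ _ → ≡.refl) (interval 0 Q))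
      (columns-↭ (↭-refl ∷ shifted-class (Q′ m) ∷ ↭-refl ∷ ↭-refl ∷ shifted-class 2 ∷ []))

    odd-differences : ∀ h → 0 ∷ (4 ℕ.+ double h) ∷ 1 ∷ 3 ∷ 2 ∷ concatMap with-suc (every-other 4 h) ↭ interval 0 (5 ℕ.+ double h)
    odd-differences h = prep 0 (begin
      X ∷ 1 ∷ 3 ∷ 2 ∷ rest                   ↭⟨ ++-comm (X ∷ []) (1 ∷ 3 ∷ 2 ∷ rest) ⟩
      1 ∷ 3 ∷ 2 ∷ rest ++ X ∷ []             ↭⟨ prep 1 (swap 3 2 (++⁺ʳ (X ∷ []) (concatMap-with-suc-every-other 4 h))) ⟩
      1 ∷ 2 ∷ 3 ∷ interval 4 (double h) ++ X ∷ []   ≡⟨ ≡.cong (λ xs → 1 ∷ 2 ∷ 3 ∷ xs) (interval-∷ʳ 4 (double h)) ⟨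
      interval 1 (4 ℕ.+ double h)            ∎)
      where
      open PermutationReasoning
      X = 4 ℕ.+ double h
      rest = concatMap with-suc (every-other 4 h)

    transversal-walk : 4 ≤ Q → Σ Walk λ w → IsLoopAt (A 0) w × Visits w (A 0) × labels w ↭ transversals m
    transversal-walk 4≤Q with parity Q
    ... | even (suc h′) Q≡2h = zigzags (every-other 0 (suc h′)) , zigzags-loop (every-other 0 (suc h′)) , here (λ k → refl) , (begin
      labels (zigzags (every-other 0 (suc h′)))                    ↭⟨ labels-zigzags (every-other 0 (suc h′)) ⟩
      concatMap D (concatMap with-suc (every-other 0 (suc h′)))    ↭⟨ concatMap⁺ D (concatMap-with-suc-every-other 0 (suc h′)) ⟩
      concatMap D (interval 0 (double (suc h′)))                   ≡⟨ ≡.cong (λ n → concatMap D (interval 0 n)) Q≡2h ⟨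
      concatMap D (interval 0 Q)                            ≡⟨ transversals≡concatMap-D ⟨
      transversals m                                        ∎)
      where open PermutationReasoning
    ... | odd (suc (suc h)) Q≡5+2h = triangles ++ zigzags (every-other 4 h) ,
      loop-++ {w₁ = triangles} triangles-loop (zigzags-loop (every-other 4 h)) , here (λ k → refl) , (begin
      labels (triangles ++ zigzags (every-other 4 h))                                 ≡⟨ map-++ proj₂ triangles (zigzags (every-other 4 h)) ⟩
      labels triangles ++ labels (zigzags (every-other 4 h))                          ↭⟨ ++⁺ labels-triangles (labels-zigzags (every-other 4 h)) ⟩
      concatMap D (0 ∷ Q′ m ∷ 1 ∷ 3 ∷ 2 ∷ []) ++ concatMap D (concatMap with-suc (every-other 4 h))
        ≡⟨ concatMap-++ D (0 ∷ Q′ m ∷ 1 ∷ 3 ∷ 2 ∷ []) (concatMap with-suc (every-other 4 h)) ⟨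
      concatMap D (0 ∷ Q′ m ∷ 1 ∷ 3 ∷ 2 ∷ concatMap with-suc (every-other 4 h))       ↭⟨ concatMap⁺ D differences ⟩
      concatMap D (interval 0 Q)                                                      ≡⟨ transversals≡concatMap-D ⟨
      transversals m                                                                  ∎)
      where
      open PermutationReasoning
      differences : 0 ∷ Q′ m ∷ 1 ∷ 3 ∷ 2 ∷ concatMap with-suc (every-other 4 h) ↭ interval 0 Q
      differences = ≡.subst (λ n → 0 ∷ pred n ∷ 1 ∷ 3 ∷ 2 ∷ concatMap with-suc (every-other 4 h) ↭ interval 0 n)
                            (≡.sym Q≡5+2h) (odd-differences h)
    ... | odd zero Q≡1 = ⊥-elim (ℕ.<⇒≱ 4≤Q (ℕ.≤-trans (ℕ.≤-reflexive Q≡1) (s≤s z≤n)))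
    ... | odd (suc zero) Q≡3 = ⊥-elim (ℕ.<⇒≱ 4≤Q (ℕ.≤-reflexive Q≡3))

module PlaneWalk {c ℓ : Level} (R : CommutativeRing c ℓ) (isField : IsField R) (q₀ : ℕ)
  (card : HasCardinality R (suc (suc q₀))) where

  open Lists
  open Fields
  open Codes
  open import Data.Nat as ℕ using (ℕ; zero; suc; _∸_; _<_; _≤_; z≤n; s≤s)
  import Data.Nat.Properties as ℕ
  open import Data.Nat.DivMod using (_%_; m<n⇒m%n≡m; n%n≡0; m%n<n)
  open import Data.Fin using (suc; #_)
  open import Data.Vec using ([]; _∷_)
  open import Data.Vec.Functional using () renaming (_∷_ to _∷ᵥ_)
  open import Data.List using ([]; _∷_; _++_; map; concatMap; cartesianProductWith)
  open import Data.List.Properties using (map-++; map-∘)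
  open import Data.List.Relation.Unary.Any using (here; there)
  import Data.List.Relation.Unary.Any.Properties as Any
  open import Data.List.Relation.Binary.Pointwise using ([]; _∷_)
  open import Data.List.Relation.Binary.Permutation.Propositional
    using (_↭_; ↭-trans; ↭-reflexive; prep; module PermutationReasoning)
  open import Data.List.Relation.Binary.Permutation.Propositional.Properties
    using (++⁺; ++⁺ˡ; ++⁺ʳ; ++-comm; ++-commutativeMonoid)
  import Algebra.Solver.CommutativeMonoid as CommutativeMonoidSolver
  open import Data.Product using (proj₁; proj₂)
  open import Relation.Binary.PropositionalEquality as ≡ using (_≡_; _≢_)

  open CommutativeRing R hiding (zero)
  open FieldProperties R isField
  open TransversalWalks R isField q₀ card
  open Transversal 0 public

  Q≡q : Q ≡ q
  Q≡q = ≡.trans (Q≡q^[1+m] 0) (ℕ.*-identityʳ q)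

  vertical : ℕ → Code 1
  vertical a = within a whole

  allCodes-plane : allCodes 1 ≡ concatMap D (interval 0 Q) ++ map vertical (interval 0 Q)
  allCodes-plane = ≡.cong₂ _++_ transversals≡concatMap-D (begin
    cartesianProductWith within (interval 0 q) (whole ∷ [])    ≡⟨ cartesianProductWith-concatMap within (interval 0 q) (whole ∷ []) ⟩
    concatMap (λ a → vertical a ∷ []) (interval 0 q)          ≡⟨ concatMap-[-] vertical (interval 0 q) ⟩
    map vertical (interval 0 q)                               ≡⟨ ≡.cong (λ n → map vertical (interval 0 n)) Q≡q ⟨
    map vertical (interval 0 Q)                               ∎)
    where open ≡.≡-Reasoning

  Ev-direction≠0 : NonZeroVec {2} (0# ∷ᵥ (λ _ → 1#))
  Ev-direction≠0 e≋0 = 1≉0 (e≋0 (suc zero))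

  Ev : PG 2
  Ev = inf (0# ∷ᵥ (λ _ → 1#)) Ev-direction≠0

  private
    on-vertical : ∀ {a t} (v : Point 1) → t ≈ element a → (t ∷ᵥ v) ≋ (origin (vertical a) ⊕ (v zero · direction (vertical a)))
    on-vertical v t≈a zero       = trans t≈a (sym (x+t*0≈x _ _))
    on-vertical v t≈a (suc zero) = sym (trans (+-identityˡ _) (*-identityʳ _))

    Ev≋1·direction : ∀ a → (0# ∷ᵥ (λ _ → 1#)) ≋ (1# · direction (vertical a))
    Ev≋1·direction a k = sym (*-identityˡ _)

  aff-Ev : ∀ {a t v} → t ≈ element a → Window (aff (t ∷ᵥ v)) Ev (vertical a)
  aff-Ev {a} {v = v} t≈a = represents-aff-inf {e≠0 = Ev-direction≠0} (v zero) 1# 1≉0 (on-vertical v t≈a) (Ev≋1·direction a)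

  Ev-aff : ∀ {a t v} → t ≈ element a → Window Ev (aff (t ∷ᵥ v)) (vertical a)
  Ev-aff {a} {v = v} t≈a = represents-inf-aff {e≠0 = Ev-direction≠0} (v zero) 1# 1≉0 (on-vertical v t≈a) (Ev≋1·direction a)

  aff-aff-vertical : ∀ {a t t′ v v′} → t ≈ element a → t′ ≈ element a → v′ zero - v zero ≉ 0# →
                     Window (aff (t ∷ᵥ v)) (aff (t′ ∷ᵥ v′)) (vertical a)
  aff-aff-vertical {a} {v = v} {v′} t≈a t′≈a v′-v≉0 =
    represents-aff-aff (v zero) (v′ zero) (direction≠0 (vertical a)) v′-v≉0 (on-vertical v t≈a) (on-vertical v′ t′≈a)

  element≉0 : ∀ {j} → 1 ≤ j → j < q → element j ≉ 0#
  element≉0 {suc j} _ 1+j<q e≈0 with element-injective 1+j<q (s≤s z≤n) (trans e≈0 (sym element-0))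
  ... | ()

  module CM = CommutativeMonoidSolver (++-commutativeMonoid {A = Code 1})

  -- For even q: the zigzag between D 1 and D 0 detours, for its second half, through the points P i and P′ i
  -- at heights i - q/2 and i, so that the visits to Ev between them pick up all q vertical lines.
  module Even (h′ : ℕ) (Q≡2h : Q ≡ double (suc h′)) where

    h : ℕ
    h = suc h′

    Q≡h+h : Q ≡ h ℕ.+ h
    Q≡h+h = ≡.trans Q≡2h (double≡+ h)

    h<Q : h < Q
    h<Q = ≡.subst (h <_) (≡.sym Q≡h+h) (ℕ.m<m+n h (s≤s z≤n))

    P : ℕ → PG 2
    P i = point i ((i ℕ.+ 0) % Q) (element (i ∸ h))

    P′ : ℕ → PG 2
    P′ i = point i ((i ℕ.+ 1) % Q) (element i)

    vertical-block : ℕ → Walk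
    vertical-block i = (P i , vertical (i ∸ h)) ∷ (Ev , vertical i) ∷ (P′ i , across i 1) ∷ (I ((i ℕ.+ 1) % Q) , across (suc i % Q) 0) ∷ []

    first-half second-half rest : Walk
    first-half  = concatMap (zigzag-block 0) (interval 0 h)
    second-half = concatMap vertical-block (interval h h)
    rest        = zigzags (every-other 2 h′)

    I-P : ∀ i → suc i < Q → Window (I ((i ℕ.+ 1) % Q)) (P (suc i)) (across (suc i % Q) 0)
    I-P i 1+i<Q = ≡.subst (λ j → Window (I ((i ℕ.+ 1) % Q)) (P (suc i)) (across j 0)) (≡.sym (m<n⇒m%n≡m 1+i<Q))
      (I-point {suc i} {0} (element (suc i ∸ h)) (≡.cong (_% Q) (≡.trans (ℕ.+-identityʳ (suc i)) (ℕ.+-comm 1 i))))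

    first-half-steps : Steps first-half (P h)
    first-half-steps = Steps-blocks (zigzag-block 0) A (λ _ _ → ≡.refl) 0 h′
      (λ i _ i<h′ → zigzag-block-steps 0 i (A-next (ℕ.<-trans (s≤s i<h′) h<Q)))
      (A-I ≡.refl , I-P h′ h<Q , _)

    second-half-steps : Steps second-half (A 0)
    second-half-steps = Steps-blocks vertical-block P (λ _ _ → ≡.refl) h h′ inner last
      where
      block-steps : ∀ i {z} → Window (I ((i ℕ.+ 1) % Q)) z (across (suc i % Q) 0) → Steps (vertical-block i) z
      block-steps i I-z = aff-Ev refl , Ev-aff refl , point-I {i} {1} (element i) ≡.refl , I-z , _
      inner : ∀ i → h ≤ i → i < h ℕ.+ h′ → Steps (vertical-block i) (P (suc i))
      inner i _ i<h+h′ = block-steps i {P (suc i)} (I-P i (≡.subst (suc i <_) (≡.trans (≡.sym (ℕ.+-suc h h′)) (≡.sym Q≡h+h)) (s≤s i<h+h′)))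
      last : Steps (vertical-block (h ℕ.+ h′)) (A 0)
      last = block-steps (h ℕ.+ h′) {A 0} (I-A-suc (h ℕ.+ h′) 0 (A-wrap (≡.trans (≡.sym (ℕ.+-suc h h′)) (≡.sym Q≡h+h))))

    walk : Walk
    walk = first-half ++ second-half ++ rest

    walk-loop : IsLoopAt (A 0) walk
    walk-loop = ≡.refl ,
      Steps-++ first-half (second-half ++ rest) (A 0)
        (≡.subst (Steps first-half) (≡.sym (start-++ second-half rest (A 0))) first-half-steps)
        (Steps-++ second-half rest (A 0) (≡.subst (Steps second-half) (≡.sym (proj₁ rest-loop)) second-half-steps) (proj₂ rest-loop))
      where rest-loop = zigzags-loop (every-other 2 h′)

    walk-visits-Ev : Visits walk Ev
    walk-visits-Ev = Any.++⁺ʳ first-half (Any.++⁺ˡ {xs = second-half} {ys = rest} (there (here (λ k → refl))))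

    labels-walk : labels walk ↭ allCodes 1
    labels-walk = begin
      labels walk
        ≡⟨ ≡.trans (map-++ proj₂ first-half _) (≡.cong (labels first-half ++_) (map-++ proj₂ second-half rest)) ⟩
      labels first-half ++ labels second-half ++ labels rest
        ↭⟨ ++⁺ (labels-blocks (zigzag-block 0) _ (λ _ → ≡.refl) I₀)
               (++⁺ (labels-blocks vertical-block _ (λ _ → ≡.refl) I₁) (labels-zigzags (every-other 2 h′))) ⟩
      (map a I₀ ++ map b I₀ ++ []) ++ (map v I₁ ++ map vertical I₁ ++ map a I₁ ++ map b I₁ ++ []) ++ Z
        ↭⟨ rearrange (map a I₀) (map b I₀) (map v I₁) (map vertical I₁) (map a I₁) (map b I₁) Z ⟩
      ((map a I₀ ++ map a I₁) ++ (map b I₀ ++ map b I₁) ++ Z) ++ (map v I₁ ++ map vertical I₁)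
        ≡⟨ ≡.cong₂ _++_ (≡.cong₂ (λ xs ys → xs ++ ys ++ Z) (whole-range a) (whole-range b)) verticals ⟩
      (map a (interval 0 Q) ++ map b (interval 0 Q) ++ Z) ++ map vertical (interval 0 Q)
        ↭⟨ ++⁺ʳ _ (++⁺ˡ (D 1) (++⁺ʳ Z (shifted-class 0))) ⟩
      concatMap D (concatMap with-suc (every-other 0 h)) ++ map vertical (interval 0 Q)
        ↭⟨ ++⁺ʳ _ (concatMap⁺ D (concatMap-with-suc-every-other 0 h)) ⟩
      concatMap D (interval 0 (double h)) ++ map vertical (interval 0 Q)
        ≡⟨ ≡.cong (λ n → concatMap D (interval 0 n) ++ map vertical (interval 0 Q)) Q≡2h ⟨
      concatMap D (interval 0 Q) ++ map vertical (interval 0 Q)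
        ≡⟨ allCodes-plane ⟨
      allCodes 1 ∎
      where
      open PermutationReasoning
      I₀ = interval 0 h
      I₁ = interval h h
      a b v : ℕ → Code 1
      a i = across i 1
      b i = across (suc i % Q) 0
      v i = vertical (i ∸ h)
      Z = concatMap D (concatMap with-suc (every-other 2 h′))
      whole-range : ∀ f → map f I₀ ++ map f I₁ ≡ map f (interval 0 Q)
      whole-range f = ≡.trans (≡.sym (map-++ f I₀ I₁)) (≡.cong (map f) (≡.trans (≡.sym (interval-++ 0 h h)) (≡.cong (interval 0) (≡.sym Q≡h+h))))
      verticals : map v I₁ ++ map vertical I₁ ≡ map vertical (interval 0 Q)
      verticals = ≡.trans (≡.cong (_++ map vertical I₁) v-range) (whole-range vertical)
        where
        v-range : map v I₁ ≡ map vertical I₀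
        v-range = ≡.trans (map-∘ I₁) (≡.cong (map vertical)
                    (≡.trans (≡.cong (λ c → map (_∸ h) (interval c h)) (≡.sym (ℕ.+-identityʳ h))) (map-∸-interval h 0 h)))
      rearrange : ∀ a₀ b₀ v₁ w₁ a₁ b₁ z → (a₀ ++ b₀ ++ []) ++ (v₁ ++ w₁ ++ a₁ ++ b₁ ++ []) ++ z ↭ ((a₀ ++ a₁) ++ (b₀ ++ b₁) ++ z) ++ (v₁ ++ w₁)
      rearrange a₀ b₀ v₁ w₁ a₁ b₁ z = CM.prove 7
        ((A₀ ⊞ B₀ ⊞ CM.id) ⊞ (V₁ ⊞ W₁ ⊞ A₁ ⊞ B₁ ⊞ CM.id) ⊞ Z′) (((A₀ ⊞ A₁) ⊞ (B₀ ⊞ B₁) ⊞ Z′) ⊞ (V₁ ⊞ W₁))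
        (a₀ ∷ b₀ ∷ v₁ ∷ w₁ ∷ a₁ ∷ b₁ ∷ z ∷ [])
        where
        open CM using (var) renaming (_⊕_ to _⊞_)
        A₀ = var (# 0); B₀ = var (# 1); V₁ = var (# 2); W₁ = var (# 3); A₁ = var (# 4); B₁ = var (# 5); Z′ = var (# 6)

  -- For odd q: S j is the point at height j on A j + ⟨I (1+j)⟩ and E j the point at height 1+j on A (1+j) + ⟨I j⟩.
  -- The blocks S j → A j → I j → E j → S (1+j), 1 ≤ j ≤ q-2, cover D 1, D 0, D (q-1) and the verticals at
  -- heights 2 … q-1; the closing part covers the indices q-1 and 0 and the verticals at heights 0 and 1.
  module Odd (h′ : ℕ) (Q≡3+2h : Q ≡ 3 ℕ.+ double h′) where

    p top : ℕ
    p   = suc (double h′)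
    top = suc p

    top≡Q′ : top ≡ Q′ 0
    top≡Q′ = ℕ.suc-injective (≡.sym Q≡3+2h)

    top<Q : top < Q
    top<Q = ≡.subst (top <_) (≡.sym Q≡3+2h) ℕ.≤-refl

    S E : ℕ → PG 2
    S j = point j ((j ℕ.+ 1) % Q) (element j)
    E j = point (suc j % Q) ((suc j % Q ℕ.+ Q′ 0) % Q) (element (suc j))

    chain-block : ℕ → Walk
    chain-block j = (S j , across j 1) ∷ (A j , across j 0) ∷ (I j , across (suc j % Q) (Q′ 0)) ∷ (E j , vertical (suc j)) ∷ []

    rest : Walk
    rest = zigzags (every-other 2 h′)

    closing : Walk
    closing = (S top , across top 1) ∷ (A top , across top 0) ∷ (I top , across (suc top % Q) (Q′ 0))
            ∷ (A 0 , across 0 0) ∷ (I 0 , across (suc 0 % Q) (Q′ 0)) ∷ (Y 0 , across 0 1)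
            ∷ (rest ++ (A 0 , vertical 0) ∷ (Ev , vertical 1) ∷ [])

    chain : Walk
    chain = concatMap chain-block (interval 1 p)

    walk : Walk
    walk = chain ++ closing

    private
      S-A : ∀ {j} → 1 ≤ j → j < Q → Window (S j) (A j) (across j 1)
      S-A {j} 1≤j j<Q = point-A {j} {1} (element≉0 1≤j (≡.subst (j <_) Q≡q j<Q))

      j+2≢j : ∀ {j} → (suc j ℕ.+ 1) % Q ≢ j % Q
      j+2≢j {j} eq with +-%-cancelˡ j {2} {0} (≡.subst (2 <_) (≡.sym Q≡3+2h) (s≤s (s≤s (s≤s z≤n)))) (s≤s z≤n)
                          (≡.trans (≡.cong (_% Q) (≡.trans (ℕ.+-comm j 2) (≡.cong suc (ℕ.+-comm 1 j))))
                                   (≡.trans eq (≡.cong (_% Q) (≡.sym (ℕ.+-identityʳ j)))))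
      ... | ()

      E-S : ∀ j → 1 ≤ j → suc j < Q → Window (E j) (S (suc j)) (vertical (suc j))
      E-S j 1≤j 1+j<Q = aff-aff-vertical refl refl
        (λ diff≈0 → *-≉0 t≉0 (x-y≉0 b≉a) (trans (sym ([x′+cb]-[x+ca]≈c[b-a] t a b x≈x′)) diff≈0))
        where
        t = element (suc j)
        a = vector 0 ((suc j % Q ℕ.+ Q′ 0) % Q) zero
        b = vector 0 ((suc j ℕ.+ 1) % Q) zero
        t≉0 : t ≉ 0#
        t≉0 = element≉0 (s≤s z≤n) (≡.subst (suc j <_) Q≡q 1+j<Q)
        x≈x′ : vector 0 (suc j % Q) zero ≈ vector 0 (suc j) zero
        x≈x′ = reflexive (≡.cong (λ i → vector 0 i zero) (m<n⇒m%n≡m 1+j<Q))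
        b≉a : b ≉ a
        b≉a b≈a = j+2≢j {j} (≡.trans (vector-injective 0 (m%n<n (suc j ℕ.+ 1) Q) j<Q λ { zero → b≈vⱼ })
                                     (≡.sym (m<n⇒m%n≡m j<Q)))
          where
          j<Q = ℕ.<-trans (ℕ.n<1+n j) 1+j<Q
          b≈vⱼ : b ≈ vector 0 j zero
          b≈vⱼ = trans b≈a (reflexive (≡.cong (λ i → vector 0 i zero) (suc-%-+-Q′ j<Q)))

    chain-steps : Steps chain (S top)
    chain-steps = Steps-blocks chain-block S (λ _ _ → ≡.refl) 1 (double h′)
      (λ j 1≤j j<p → block-steps j 1≤j (ℕ.<-trans (s≤s j<p) top<Q)) (block-steps p (s≤s z≤n) top<Q)
      where
      block-steps : ∀ j → 1 ≤ j → suc j < Q → Steps (chain-block j) (S (suc j))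
      block-steps j 1≤j 1+j<Q = S-A 1≤j j<Q , A-I-0 j<Q , I-point (element (suc j)) (suc-%-+-Q′ j<Q) , E-S j 1≤j 1+j<Q , _
        where j<Q = ℕ.<-trans (ℕ.n<1+n j) 1+j<Q

    closing-steps : Steps closing (S 1)
    closing-steps =
      S-A (s≤s z≤n) top<Q , A-I-0 top<Q ,
      ≡.subst (λ j → Window (I top) (A j) (across (suc top % Q) (Q′ 0))) top+1%Q≡0 (I-A {suc top % Q} {Q′ 0} (suc-%-+-Q′ top<Q)) ,
      A-I-0 (s≤s z≤n) , I-Y (s≤s z≤n) ,
      ≡.subst (λ z → Window (Y 0) z (across 0 1)) (≡.sym (≡.trans (start-++ rest _ (S 1)) (proj₁ rest-loop))) (point-A {0} {1} 1≉0) ,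
      Steps-++ rest ((A 0 , vertical 0) ∷ (Ev , vertical 1) ∷ []) (S 1) (proj₂ rest-loop) (aff-Ev (sym element-0) , Ev-aff refl , _)
      where
      rest-loop = zigzags-loop (every-other 2 h′)
      top+1%Q≡0 : suc top % Q ≡ 0
      top+1%Q≡0 = ≡.trans (≡.cong (_% Q) (≡.sym Q≡3+2h)) (n%n≡0 Q)

    walk-loop : IsLoopAt (S 1) walk
    walk-loop = ≡.refl , Steps-++ chain closing (S 1) chain-steps closing-steps

    walk-visits-A0 : Visits walk (A 0)
    walk-visits-A0 = Any.++⁺ʳ chain (there (there (there (here (λ k → refl)))))

    walk-visits-Ev : Visits walk Ev
    walk-visits-Ev = Any.++⁺ʳ chain (there (there (there (there (there (there (Any.++⁺ʳ rest (there (here (λ k → refl))))))))))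

    labels-walk : labels walk ↭ allCodes 1
    labels-walk = begin
      labels walk
        ≡⟨ ≡.trans (map-++ proj₂ chain closing)
                   (≡.cong (λ ls → labels chain ++ a₁ ∷ a₀ ∷ aᵣ ∷ b₀ ∷ bᵣ ∷ b₁ ∷ ls) (map-++ proj₂ rest _)) ⟩
      labels chain ++ a₁ ∷ a₀ ∷ aᵣ ∷ b₀ ∷ bᵣ ∷ b₁ ∷ (labels rest ++ vertical 0 ∷ vertical 1 ∷ [])
        ↭⟨ ++⁺ (labels-blocks chain-block _ (λ _ → ≡.refl) (interval 1 p))
               (prep a₁ (prep a₀ (prep aᵣ (prep b₀ (prep bᵣ (prep b₁ (++⁺ʳ _ (labels-zigzags (every-other 2 h′))))))))) ⟩
      (M₁ ++ M₀ ++ Mᵣ ++ Mᵥ ++ []) ++ a₁ ∷ a₀ ∷ aᵣ ∷ b₀ ∷ bᵣ ∷ b₁ ∷ (Z ++ vertical 0 ∷ vertical 1 ∷ [])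
        ↭⟨ rearrange M₁ M₀ Mᵣ Mᵥ Z a₁ a₀ aᵣ b₀ bᵣ b₁ (vertical 0) (vertical 1) ⟩
      ((b₀ ∷ M₀ ++ a₀ ∷ []) ++ (b₁ ∷ M₁ ++ a₁ ∷ []) ++ (bᵣ ∷ Mᵣ ++ aᵣ ∷ []) ++ Z) ++ (vertical 0 ∷ vertical 1 ∷ Mᵥ)
        ≡⟨ ≡.cong₂ _++_ (≡.cong₂ _++_ (split (λ i → across i 0))
                                      (≡.cong₂ _++_ (split (λ i → across i 1)) (≡.cong (_++ Z) (split r))))
                        verticals ⟨
      (D 0 ++ D 1 ++ map r (interval 0 Q) ++ Z) ++ map vertical (interval 0 Q)
        ↭⟨ ++⁺ʳ _ (++⁺ˡ (D 0) (++⁺ˡ (D 1) (++⁺ʳ Z (shifted-class (Q′ 0))))) ⟩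
      concatMap D (0 ∷ 1 ∷ Q′ 0 ∷ concatMap with-suc (every-other 2 h′)) ++ map vertical (interval 0 Q)
        ↭⟨ ++⁺ʳ _ (concatMap⁺ D differences) ⟩
      concatMap D (interval 0 Q) ++ map vertical (interval 0 Q)
        ≡⟨ allCodes-plane ⟨
      allCodes 1 ∎
      where
      open PermutationReasoning
      r : ℕ → Code 1
      r j = across (suc j % Q) (Q′ 0)
      a₁ = across top 1
      a₀ = across top 0
      aᵣ = r top
      b₀ = across 0 0
      bᵣ = r 0
      b₁ = across 0 1
      M₁ = map (λ j → across j 1) (interval 1 p)
      M₀ = map (λ j → across j 0) (interval 1 p)
      Mᵣ = map r (interval 1 p)
      Mᵥ = map (λ j → vertical (suc j)) (interval 1 p)
      Z = concatMap D (concatMap with-suc (every-other 2 h′))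
      interval-Q : interval 0 Q ≡ 0 ∷ 1 ∷ interval 2 p
      interval-Q = ≡.cong (interval 0) Q≡3+2h
      split : ∀ f → map f (interval 0 Q) ≡ f 0 ∷ map f (interval 1 p) ++ f top ∷ []
      split f = ≡.trans (≡.cong (map f) (≡.trans interval-Q (≡.cong (0 ∷_) (interval-∷ʳ 1 p))))
                        (≡.cong (f 0 ∷_) (map-++ f (interval 1 p) (top ∷ [])))
      verticals : map vertical (interval 0 Q) ≡ vertical 0 ∷ vertical 1 ∷ Mᵥ
      verticals = ≡.trans (≡.cong (map vertical) interval-Q)
                    (≡.cong (λ vs → vertical 0 ∷ vertical 1 ∷ vs)
                            (≡.trans (≡.cong (map vertical) (≡.sym (map-suc-interval 1 p))) (≡.sym (map-∘ (interval 1 p)))))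
      differences : 0 ∷ 1 ∷ Q′ 0 ∷ concatMap with-suc (every-other 2 h′) ↭ interval 0 Q
      differences = ≡.subst (λ n → 0 ∷ 1 ∷ n ∷ concatMap with-suc (every-other 2 h′) ↭ interval 0 Q) top≡Q′
        (↭-trans (prep 0 (prep 1 (↭-trans (++-comm (top ∷ []) (concatMap with-suc (every-other 2 h′)))
          (↭-trans (++⁺ʳ (top ∷ []) (concatMap-with-suc-every-other 2 h′)) (↭-reflexive (≡.sym (interval-∷ʳ 2 (double h′))))))))
          (↭-reflexive (≡.sym interval-Q)))
      rearrange : ∀ m₁ m₀ mᵣ mᵥ z a₁ a₀ aᵣ b₀ bᵣ b₁ v₀ v₁ →
        (m₁ ++ m₀ ++ mᵣ ++ mᵥ ++ []) ++ a₁ ∷ a₀ ∷ aᵣ ∷ b₀ ∷ bᵣ ∷ b₁ ∷ (z ++ v₀ ∷ v₁ ∷ [])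
        ↭ ((b₀ ∷ m₀ ++ a₀ ∷ []) ++ (b₁ ∷ m₁ ++ a₁ ∷ []) ++ (bᵣ ∷ mᵣ ++ aᵣ ∷ []) ++ z) ++ (v₀ ∷ v₁ ∷ mᵥ)
      rearrange m₁ m₀ mᵣ mᵥ z a₁ a₀ aᵣ b₀ bᵣ b₁ v₀ v₁ = CM.prove 13
        ((M₁′ ⊞ M₀′ ⊞ Mᵣ′ ⊞ Mᵥ′ ⊞ CM.id) ⊞ (A₁ ⊞ A₀ ⊞ Aᵣ ⊞ B₀ ⊞ Bᵣ ⊞ B₁ ⊞ (Z′ ⊞ V₀ ⊞ V₁)))
        (((B₀ ⊞ M₀′ ⊞ A₀) ⊞ (B₁ ⊞ M₁′ ⊞ A₁) ⊞ (Bᵣ ⊞ Mᵣ′ ⊞ Aᵣ) ⊞ Z′) ⊞ (V₀ ⊞ V₁ ⊞ Mᵥ′))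
        (m₁ ∷ m₀ ∷ mᵣ ∷ mᵥ ∷ z ∷ (a₁ ∷ []) ∷ (a₀ ∷ []) ∷ (aᵣ ∷ []) ∷ (b₀ ∷ []) ∷ (bᵣ ∷ []) ∷ (b₁ ∷ [])
          ∷ (v₀ ∷ []) ∷ (v₁ ∷ []) ∷ [])
        where
        open CM using (var) renaming (_⊕_ to _⊞_)
        M₁′ = var (# 0); M₀′ = var (# 1); Mᵣ′ = var (# 2); Mᵥ′ = var (# 3); Z′ = var (# 4)
        A₁ = var (# 5); A₀ = var (# 6); Aᵣ = var (# 7); B₀ = var (# 8); Bᵣ = var (# 9); B₁ = var (# 10); V₀ = var (# 11); V₁ = var (# 12)

  plane-walk : Σ Walk λ w → IsClosed w × labels w ↭ allCodes 1 × Visits w (A 0) × Visits w Ev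
  plane-walk with parity Q
  ... | even (suc h′) Q≡2h   = let open Even h′ Q≡2h in
    walk , IsLoopAt⇒IsClosed walk walk-loop , labels-walk , here (λ k → refl) , walk-visits-Ev
  ... | odd (suc h′) Q≡3+2h  = let open Odd h′ Q≡3+2h in
    walk , IsLoopAt⇒IsClosed walk walk-loop , labels-walk , walk-visits-A0 , walk-visits-Ev
  ... | odd zero Q≡1 = ⊥-elim (ℕ.1+n≢0 (ℕ.suc-injective (≡.trans (≡.sym Q≡q) Q≡1)))

module AllLines {c ℓ : Level} (R : CommutativeRing c ℓ) (isField : IsField R) (q₀ : ℕ)
  (card : HasCardinality R (suc (suc q₀))) where

  open Lists
  open Fields
  open Codes
  open import Data.Nat as ℕ using (ℕ; zero; suc; _≥_; _≤_; z≤n; s≤s)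
  import Data.Nat.Properties as ℕ
  open import Data.Fin using (suc)
  open import Data.Vec.Functional using () renaming (_∷_ to _∷ᵥ_)
  open import Data.List using ([]; _∷_; _++_; map; concat; length; cartesianProductWith)
  open import Data.List.Properties using (map-++; map-∘; ++-assoc)
  import Data.List.Relation.Unary.Any as Any
  import Data.List.Relation.Unary.Any.Properties as Any
  open import Data.List.Relation.Unary.All using (All)
  import Data.List.Relation.Unary.All as All
  import Data.List.Relation.Unary.All.Properties as All
  open import Data.List.Relation.Binary.Permutation.Propositional
    using (_↭_; ↭-refl; ↭-trans; ↭-sym; ↭-reflexive; module PermutationReasoning)
  open import Data.List.Relation.Binary.Permutation.Propositional.Properties using (++⁺; ++⁺ˡ; ++⁺ʳ; map⁺; Any-resp-↭)
  open import Data.Product using (proj₁; proj₂)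
  open import Relation.Binary.PropositionalEquality as ≡ using (_≡_)

  open CommutativeRing R hiding (zero)
  open FieldProperties R isField
  open TransversalWalks R isField q₀ card
  open PlaneWalk R isField q₀ card using (plane-walk)

  last-axis : ∀ m → Point (suc (suc m))
  last-axis zero    = 0# ∷ᵥ (λ _ → 1#)
  last-axis (suc m) = 0# ∷ᵥ last-axis m

  last-axis≠0 : ∀ m → NonZeroVec (last-axis m)
  last-axis≠0 zero    e≋0 = 1≉0 (e≋0 (suc zero))
  last-axis≠0 (suc m) e≋0 = last-axis≠0 m (λ k → e≋0 (suc k))

  ∞-last : ∀ m → PG (suc (suc m))
  ∞-last m = inf (last-axis m) (last-axis≠0 m)

  module Embedding (m : ℕ) where

    module Lower = Walks m
    module Upper = Walks (suc m)

    embed-walk : ℕ → Lower.Walk → Upper.Walk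
    embed-walk a = map (λ (p , κ) → embed (element a) p , within a κ)

    embed-Steps : ∀ a w z → Lower.Steps w z → Upper.Steps (embed-walk a w) (embed (element a) z)
    embed-Steps a []                  z _       = _
    embed-Steps a ((p , κ) ∷ [])      z (e , _) = Represents-embed (element a) e , _
    embed-Steps a ((p , κ) ∷ y ∷ w)   z (e , s) = Represents-embed (element a) e , embed-Steps a (y ∷ w) z s

    embed-closed : ∀ a w → Lower.IsClosed w → Upper.IsClosed (embed-walk a w)
    embed-closed a []            _      _ = _
    embed-closed a ((p , κ) ∷ w) closed _ = embed-Steps a ((p , κ) ∷ w) p (closed p)

    labels-embed : ∀ a w → Upper.labels (embed-walk a w) ≡ map (within a) (Lower.labels w)
    labels-embed a w = ≡.trans (≡.sym (map-∘ w)) (map-∘ w)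

    embed-visits : ∀ a w {y} → Lower.Visits w y → Upper.Visits (embed-walk a w) (embed (element a) y)
    embed-visits a w visit = Any.map⁺ (Any.map (embed-cong (element a)) visit)

  FullWalk : ℕ → Set _
  FullWalk m = Σ Walk λ w → IsClosed w × labels w ↭ allCodes (suc m) × Visits w (aff 0ᵥ) × Visits w (∞-last m)
    where open Walks (suc m)

  4≤Q : ∀ m → 4 ≤ Transversal.Q (suc m)
  4≤Q m = ≡.subst (4 ≤_) (≡.sym (Q≡q^[1+m] (suc m)))
            (ℕ.*-mono-≤ {2} {q} (s≤s (s≤s z≤n)) (ℕ.*-mono-≤ {2} {q} (s≤s (s≤s z≤n)) (ℕ.m^n>0 q m)))

  module Copies {m} (w : Walks.Walk (suc m)) (closed : Walks.IsClosed (suc m) w)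
    (labels↭ : Walks.labels (suc m) w ↭ allCodes (suc m)) where

    open Walks (suc (suc m))
    open Embedding (suc m)
    open Setoid (PG-setoid (suc (suc (suc m)))) using () renaming (trans to ≈ᴾ-trans)

    copy : ℕ → Walk
    copy a = embed-walk a w

    copy-closed : ∀ a → IsClosed (copy a)
    copy-closed a = embed-closed a w closed

    copy-visits-0 : Lower.Visits w (aff 0ᵥ) → Visits (copy 0) (aff 0ᵥ)
    copy-visits-0 visits = Any.map (λ p≈ → ≈ᴾ-trans p≈ embedded-0≈0) (embed-visits 0 w visits)
      where
      embedded-0≈0 : embed (element 0) (aff 0ᵥ) ≈ᴾ aff 0ᵥ
      embedded-0≈0 zero    = element-0
      embedded-0≈0 (suc k) = refl

    copy-visits-∞ : Lower.Visits w (∞-last m) → ∀ a → Visits (copy a) (∞-last (suc m))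
    copy-visits-∞ visits a = embed-visits a w visits

    labels-copies : ∀ as → labels (concat (map copy as)) ↭ cartesianProductWith within as (allCodes (suc m))
    labels-copies []       = ↭-refl
    labels-copies (a ∷ as) = begin
      labels (copy a ++ concat (map copy as))                     ≡⟨ map-++ proj₂ (copy a) _ ⟩
      labels (copy a) ++ labels (concat (map copy as))            ≡⟨ ≡.cong (_++ _) (labels-embed a w) ⟩
      map (within a) (Lower.labels w) ++ labels (concat (map copy as))
        ↭⟨ ++⁺ (map⁺ (within a) labels↭) (labels-copies as) ⟩
      map (within a) (allCodes (suc m)) ++ cartesianProductWith within as (allCodes (suc m)) ∎
      where open PermutationReasoning

  full-walk : ∀ m → FullWalk m
  full-walk zero with plane-walk
  ... | w , closed , labels↭ , visits-A0 , visits-∞ =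
    w , closed , labels↭ , Any.map (λ p≈A0 → ≈ᴾ-trans p≈A0 (Transversal.A0≈origin 0)) visits-A0 , visits-∞
    where open Setoid (PG-setoid 2) using () renaming (trans to ≈ᴾ-trans)
  full-walk (suc m) with full-walk m | Transversal.transversal-walk (suc m) (4≤Q m)
  ... | w , closed , labels↭ , visits-0 , visits-∞ | t , t-loop , t-visits-A0 , t-labels =
    w₂ , closed₂ , labels₂ , Any-resp-↭ (↭-sym w₂↭) (Any.++⁺ˡ t-visits-0) , Any-resp-↭ (↭-sym w₂↭w₁) (Any.++⁺ˡ visits₁-∞)
    where
    open Walks (suc (suc m))
    open Copies w closed labels↭
    open Setoid (PG-setoid (suc (suc (suc m)))) using () renaming (trans to ≈ᴾ-trans)

    t-visits-0 : Visits t (aff 0ᵥ)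
    t-visits-0 = Any.map (λ p≈ → ≈ᴾ-trans p≈ (Transversal.A0≈origin (suc m))) t-visits-A0

    spliced = splice t-visits-0 (copy-visits-0 visits-0) (IsLoopAt⇒IsClosed t t-loop) (copy-closed 0)
    w₁ = proj₁ spliced
    w₁↭ = proj₂ (proj₂ spliced)

    visits₁-∞ : Visits w₁ (∞-last (suc m))
    visits₁-∞ = Any-resp-↭ (↭-sym w₁↭) (Any.++⁺ʳ t (copy-visits-∞ visits-∞ 0))

    spliced-all = splice-all visits₁-∞ (proj₁ (proj₂ spliced)) (map copy (interval 1 (suc q₀)))
                    (All.map⁺ (All.universal (λ a → copy-visits-∞ visits-∞ a , copy-closed a) (interval 1 (suc q₀))))
    w₂ = proj₁ spliced-all
    closed₂ = proj₁ (proj₂ spliced-all)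
    w₂↭w₁ = proj₂ (proj₂ spliced-all)

    w₂↭ : w₂ ↭ t ++ concat (map copy (interval 0 q))
    w₂↭ = ↭-trans w₂↭w₁ (↭-trans (++⁺ʳ _ w₁↭) (↭-reflexive (++-assoc t (copy 0) _)))

    labels₂ : labels w₂ ↭ allCodes (suc (suc m))
    labels₂ = begin
      labels w₂                                               ↭⟨ map⁺ proj₂ w₂↭ ⟩
      labels (t ++ concat (map copy (interval 0 q)))          ≡⟨ map-++ proj₂ t _ ⟩
      labels t ++ labels (concat (map copy (interval 0 q)))   ↭⟨ ++⁺ t-labels (labels-copies (interval 0 q)) ⟩
      allCodes (suc (suc m))                                  ∎
      where open PermutationReasoning

  cyclic-sequence : ∀ m →
    Σ ℕ λ M → Σ (Fin (suc M) → PG (suc (suc m))) λ C → ((∀ (i : Fin (suc M)) → Geometry.RepresentsSomeLine R (suc (suc m)) (C i) (C (next i)))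
      × (∀ (L : Subset (suc (suc m))) → IsAffineLine L →
          Σ (Fin (suc M)) λ i → (Represents (C i) (C (next i)) L
            × (∀ j → Represents (C j) (C (next j)) L → j ≡ i))))
  cyclic-sequence m with full-walk m
  ... | [] , _ , _ , () , _
  ... | x ∷ w , closed , labels↭ , _ , _ = length w , vertex , represents-line , represents-each-line-once
    where
    open Walks (suc m) using (module Cycle)
    open Cycle x w closed labels↭ (allCodes-unique (suc m))

    represents-line : ∀ i → Geometry.RepresentsSomeLine R (suc (suc m)) (vertex i) (vertex (next i))
    represents-line i = lineOf (label i) , (origin (label i) , direction (label i) , direction≠0 (label i) , ≃-refl) , edge i

    represents-each-line-once : ∀ L → IsAffineLine L →
      Σ _ λ i → Represents (vertex i) (vertex (next i)) L × (∀ j → Represents (vertex j) (vertex (next j)) L → j ≡ i)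
    represents-each-line-once L (x₀ , d , d≠0 , L≃) with code-exists (suc m) x₀ d d≠0
    ... | κ , κ-valid , same with label-surjective (Valid⇒∈-allCodes κ κ-valid)
    ... | i , label-i≡κ = i , Represents-≃ (edge i) lineOf-i≃L , only-i
      where
      lineOf-κ≃L : SameSet (lineOf κ) L
      lineOf-κ≃L = ≃-trans (≃-sym (SameLine⇒≃ same)) (≃-sym L≃)
      lineOf-i≃L : SameSet (lineOf (label i)) L
      lineOf-i≃L = ≡.subst (λ κ′ → SameSet (lineOf κ′) L) (≡.sym label-i≡κ) lineOf-κ≃L
      only-i : ∀ j → Represents (vertex j) (vertex (next j)) L → j ≡ i
      only-i j represents-j = label-injective j i (≡.trans label-j≡κ (≡.sym label-i≡κ))
        where
        label-j≡κ : label j ≡ κ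
        label-j≡κ = code-unique (label j) κ (∈-allCodes⇒Valid (label∈codes j)) κ-valid
          (≃⇒SameLine (direction≠0 κ) (≃-trans (Represents-unique (edge j) represents-j) (≃-sym lineOf-κ≃L)))

mainTheorem1 : ∀ {c ℓ : Level} (n q : ℕ) → n ≥ 2 → IsPrimePower q →
    (R : CommutativeRing c ℓ) → IsField R → HasCardinality R q →
    let open Geometry R n in
    Σ ℕ λ m → Σ (Fin (suc m) → PGPoint) λ C → ((∀ (i : Fin (suc m)) → RepresentsSomeLine (C i) (C (next i)))
      × (∀ (L : Vec → Set _) → IsAffineLine L →
          Σ (Fin (suc m)) λ i → (Represents (C i) (C (next i)) L
            × (∀ j → Represents (C j) (C (next j)) L → j ≡ i))))
mainTheorem1 zero          _ () _ R isField card
mainTheorem1 (suc zero)    _ (s≤s ()) _ R isField card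
mainTheorem1 (suc (suc m)) (suc (suc q₀)) _ _ R isField card = AllLines.cyclic-sequence R isField q₀ card m
mainTheorem1 (suc (suc m)) zero _ _ R isField card with HasCardinality.enum-surj card (CommutativeRing.0# R)
... | () , _
mainTheorem1 (suc (suc m)) (suc zero) _ _ R isField card
  with HasCardinality.enum-surj card (CommutativeRing.0# R) | HasCardinality.enum-surj card (CommutativeRing.1# R)
... | zero , 0↦0 | zero , 0↦1 = ⊥-elim (IsField.1≉0 isField (CommutativeRing.trans R (CommutativeRing.sym R 0↦1) 0↦0))
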